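{- For $n\ge3$, the dual $\mathcal{P}_{K_n}^\vee$ of the Laplacian simplex of the complete graph $K_n$ is unimodularly equivalent to the Laplacian simplex $\mathcal{P}_{T_n}$ of any tree $T_n$ on $n$ vertices.
   Context: The Laplacian matrix $L$ of a simple graph on $[n]$ has $L_{ii}=\deg(i)$, $L_{ij}=-1$ if $\{i,j\}$ is an edge and $0$ otherwise; the Laplacian simplex $\mathcal{P}_G$ is the convex hull in $\mathbb{R}^{n-1}$ of the rows of $L$ with its $n$-th column deleted. The dual of a full-dimensional polytope $\mathcal{P}$ containing the origin in its interior is $\{\mathbf{x}\mid\mathbf{x}\mathbf{y}^T\le1\ \forall\mathbf{y}\in\mathcal{P}\}$. Two lattice polytopes with vertices $\mathbf{v}_i$ and $\mathbf{v}'_i$ are unimodularly equivalent if there exist $U\in\mathrm{GL}_d(\mathbb{Z})$ and $\mathbf{b}\in\mathbb{Z}^d$ with $\mathbf{v}'_i=\mathbf{v}_iU+\mathbf{b}$ for all $i$ (after a suitable relabeling of vertices).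
   Formalization: Points of $\mathcal{P}_{T_n}$, $\mathcal{P}_{K_n}$ and the dual $\mathcal{P}_{K_n}^\vee$, including the test points y in the dual's definition, are taken in ℚ^(n-1) rather than $\mathbb{R}^{n-1}$. -}

module Defs where

open import Data.Nat as ℕ using (ℕ; zero; suc)
open import Data.Integer as ℤ using (ℤ; +_; -[1+_])
open import Data.Rational as ℚ using (ℚ; 0ℚ; 1ℚ; _/_)
open import Data.Fin using (Fin; zero; suc; inject₁)
open import Data.Fin.Properties using (_≟_)
open import Data.Bool using (Bool; true; false; if_then_else_; not)
open import Data.List using (List; []; _∷_; _∷ʳ_; length)
open import Data.List.Relation.Unary.Linked using (Linked)
open import Data.List.Relation.Unary.Unique.Propositional using (Unique)
open import Data.Product using (Σ; ∃; _×_; _,_)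
open import Relation.Nullary using (¬_; does)
open import Relation.Binary.PropositionalEquality using (_≡_)

sumℕ : ∀ {k} → (Fin k → ℕ) → ℕ
sumℕ {zero} f = 0
sumℕ {suc k} f = f zero ℕ.+ sumℕ (λ i → f (suc i))

sumℚ : ∀ {k} → (Fin k → ℚ) → ℚ
sumℚ {zero} f = 0ℚ
sumℚ {suc k} f = f zero ℚ.+ sumℚ (λ i → f (suc i))

sumℤ : ∀ {k} → (Fin k → ℤ) → ℤ
sumℤ {zero} f = + 0
sumℤ {suc k} f = f zero ℤ.+ sumℤ (λ i → f (suc i))

toℚ : ℤ → ℚ
toℚ z = z / 1

record Graph (n : ℕ) : Set where
  field
    adj   : Fin n → Fin n → Bool
    sym   : ∀ i j → adj i j ≡ adj j i
    irrefl : ∀ i → adj i i ≡ false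
open Graph public

Adj : ∀ {n} → Graph n → Fin n → Fin n → Set
Adj G i j = adj G i j ≡ true

data Walk {n} (G : Graph n) : Fin n → Fin n → Set where
  here : ∀ i → Walk G i i
  step : ∀ {i j k} → Adj G i j → Walk G j k → Walk G i k

Connected : ∀ {n} → Graph n → Set
Connected G = ∀ i j → Walk G i j

-- a cycle: distinct vertices v, m_1..m_r, w (r ≥ 1, so ≥ 3 vertices),
-- consecutive ones adjacent and w adjacent to v
HasCycle : ∀ {n} → Graph n → Set
HasCycle {n} G =
  Σ (Fin n) λ v → Σ (List (Fin n)) λ ms → Σ (Fin n) λ w →
    (1 ℕ.≤ length ms) × Unique (v ∷ (ms ∷ʳ w)) ×
    Linked (Adj G) (v ∷ (ms ∷ʳ w)) × Adj G w v

IsTree : ∀ {n} → Graph n → Set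
IsTree G = Connected G × ¬ HasCycle G

complete : ∀ n → Graph n
complete n = record { adj = λ i j → not (does (i ≟ j)) ; sym = symK ; irrefl = irrK }
  where
  open import Relation.Binary.PropositionalEquality using (refl; cong)
  open import Relation.Nullary using (yes; no)
  symK : ∀ i j → not (does (i ≟ j)) ≡ not (does (j ≟ i))
  symK i j with i ≟ j | j ≟ i
  ... | yes _ | yes _ = refl
  ... | no _ | no _ = refl
  ... | yes p | no q = Data.Empty.⊥-elim (q (Relation.Binary.PropositionalEquality.sym p))
    where import Data.Empty
  ... | no p | yes q = Data.Empty.⊥-elim (p (Relation.Binary.PropositionalEquality.sym q))
    where import Data.Empty
  irrK : ∀ i → not (does (i ≟ i)) ≡ false
  irrK i with i ≟ i
  ... | yes _ = refl
  ... | no p = Data.Empty.⊥-elim (p refl)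
    where import Data.Empty

degree : ∀ {n} → Graph n → Fin n → ℕ
degree G i = sumℕ (λ j → if adj G i j then 1 else 0)

laplacian : ∀ {n} → Graph n → Fin n → Fin n → ℤ
laplacian G i j =
  if does (i ≟ j) then + degree G i
  else (if adj G i j then -[1+ 0 ] else + 0)

Pt : ℕ → Set
Pt d = Fin d → ℚ

dot : ∀ {d} → Pt d → Pt d → ℚ
dot x y = sumℚ (λ j → x j ℚ.* y j)

-- rational points of the convex hull of the vertices v_0..v_{k-1}
InConv : ∀ {k d} → (Fin k → Pt d) → Pt d → Set
InConv {k} v y = Σ (Fin k → ℚ) λ λs →
  (∀ i → 0ℚ ℚ.≤ λs i) × (sumℚ λs ≡ 1ℚ) ×
  (∀ j → y j ≡ sumℚ (λ i → λs i ℚ.* v i j))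

-- vertices of the Laplacian simplex of G on n = d+1 vertices:
-- row i of L with the n-th (last) column deleted
laplacianVertex : ∀ {d} → Graph (suc d) → Fin (suc d) → Pt d
laplacianVertex G i j = toℚ (laplacian G i (inject₁ j))

InLaplacianSimplex : ∀ {d} → Graph (suc d) → Pt d → Set
InLaplacianSimplex G = InConv (laplacianVertex G)

InDual : ∀ {d} → (Pt d → Set) → Pt d → Set
InDual P x = ∀ y → P y → dot x y ℚ.≤ 1ℚ

Mat : ℕ → Set
Mat d = Fin d → Fin d → ℤ

_⊗_ : ∀ {d} → Mat d → Mat d → Mat d
(A ⊗ B) i k = sumℤ (λ j → A i j ℤ.* B j k)

idMat : ∀ {d} → Mat d
idMat i j = if does (i ≟ j) then + 1 else + 0

IsUnimodular : ∀ {d} → Mat d → Set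
IsUnimodular {d} U = Σ (Mat d) λ V →
  (∀ i j → (U ⊗ V) i j ≡ idMat i j) × (∀ i j → (V ⊗ U) i j ≡ idMat i j)

affine : ∀ {d} → Mat d → (Fin d → ℤ) → Pt d → Pt d
affine U b y j = sumℚ (λ i → y i ℚ.* toℚ (U i j)) ℚ.+ toℚ (b j)

UnimodEquiv : ∀ {d} → (Pt d → Set) → (Pt d → Set) → Set
UnimodEquiv {d} P Q = Σ (Mat d) λ U → Σ (Fin d → ℤ) λ b →
  IsUnimodular U ×
  (∀ x → Q x → Σ (Pt d) λ y → P y × (∀ j → x j ≡ affine U b y j)) ×
  (∀ y → P y → Q (affine U b y))

-- Root the tree at the last vertex n. Every edge joins a vertex to its parent, so
-- (L w)ᵢ = (wᵢ − w_parent(i)) + Σ_{children k of i} (wᵢ − wₖ), and the matrix W whose entry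
-- W_ab counts the common ancestors of a and b other than n is an integral inverse of the
-- reduced Laplacian L̃ (L without row and column n).
-- For any graph whose L̃ is unimodular, y ↦ −y L̃⁻¹ sends the vertex Lᵢ of 𝒫_G to −eᵢ (i < n)
-- and Lₙ = −Σᵢ Lᵢ to (1,…,1): a point with barycentric coordinates λ goes to x with
-- xⱼ = λₙ − λⱼ. The vertices of 𝒫_{K_n} are n eₐ − 𝟙 (a < n) and −𝟙, and ⟨x, n eₐ − 𝟙⟩ = 1 − n λₐ,
-- so x lies in the dual of 𝒫_{K_n} exactly when all λₐ are nonnegative.

module Submission where

open import Defs
open import Algebra.Bundles using (CommutativeRing)
import Algebra.Properties.Semiring.Sum as SemiringSum
open import Data.Bool using (Bool; true; false; if_then_else_)
import Data.Bool.Properties as Bool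
open import Data.Empty using (⊥-elim)
open import Data.Fin using (Fin; zero; suc; inject₁; fromℕ; punchIn)
open import Data.Fin.Properties using (_≟_; any?; inject₁-injective; fromℕ≢inject₁; punchInᵢ≢i)
open import Data.Fin.Relation.Unary.Top using (view; ‵fromℕ; ‵inject₁)
open import Data.Integer as ℤ using (ℤ; +_)
import Data.Integer.Properties as ℤ
open import Algebra.Properties.AbelianGroup ℤ.+-0-abelianGroup using (inverseʳ-unique)
open import Data.Integer.Tactic.RingSolver using (solve-∀)
open import Data.List using (List; []; _∷_; _++_; _∷ʳ_; length)
import Data.List.Properties as List
open import Data.List.Membership.Propositional using (_∈_)
open import Data.List.Membership.Propositional.Properties using (∈-++⁻)
open import Data.List.Relation.Unary.Any using (here; there)
open import Data.List.Relation.Unary.All as All using ([]; _∷_)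
open import Data.List.Relation.Unary.AllPairs using ([]; _∷_)
import Data.List.Relation.Unary.AllPairs.Properties as AllPairs
open import Data.List.Relation.Unary.Linked using (Linked; []; [-]; _∷_)
open import Data.List.Relation.Unary.Unique.Propositional using (Unique)
open import Data.Nat as ℕ using (ℕ; zero; suc; _≤_; _<_; z≤n; s≤s; _∸_)
import Data.Nat.Properties as ℕ
open import Data.Product using (Σ; ∃; _×_; _,_; proj₁; proj₂)
open import Data.Rational as ℚ using (ℚ; 0ℚ; 1ℚ)
import Data.Rational.Properties as ℚ
open import Data.Rational.Solver using (module +-*-Solver)
open +-*-Solver using (solve; _:+_; _:*_; _:-_; :-_; con; _:=_)
import Data.Rational.Unnormalised as ℚᵘ
import Data.Rational.Unnormalised.Properties as ℚᵘ
open import Data.Sum using (_⊎_; inj₁; inj₂)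
open import Function using (_∘_)
open import Relation.Nullary using (Dec; yes; no; does; ¬_; ¬?)
open import Relation.Nullary.Decidable using (_×-dec_; _⊎-dec_)
open import Relation.Unary using (Decidable)
import Relation.Binary.PropositionalEquality as ≡
open ≡ using (_≡_; _≢_; refl; trans; cong; cong₂; subst; module ≡-Reasoning)

-- S is any summation obeying the recursion of sumℤ and sumℚ; its laws are transported
-- from the library's sum.

module FinSum {c ℓ} (R : CommutativeRing c ℓ)
  (S : ∀ {k} → (Fin k → CommutativeRing.Carrier R) → CommutativeRing.Carrier R)
  (S-zero : ∀ f → S {0} f ≡ CommutativeRing.0# R)
  (S-suc : ∀ {k} f → S {suc k} f ≡ CommutativeRing._+_ R (f zero) (S (f ∘ suc)))
  where

  open CommutativeRing R hiding (refl) renaming (trans to ≈-trans; sym to ≈-sym)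
  open import Algebra.Properties.Ring ring using (-1*x≈-x)
  open import Relation.Binary.Reasoning.Setoid setoid
  private
    module ∑ = SemiringSum semiring
    variable
      k : ℕ
  open ∑ using (sum)

  S≈sum : ∀ {k} (f : Fin k → Carrier) → S f ≈ sum f
  S≈sum {zero} f = reflexive (S-zero f)
  S≈sum {suc k} f = ≈-trans (reflexive (S-suc f)) (+-congˡ (S≈sum (f ∘ suc)))

  sum-cong : ∀ {f g : Fin k → Carrier} → (∀ i → f i ≈ g i) → S f ≈ S g
  sum-cong {f = f} {g} f≈g = begin
    S f   ≈⟨ S≈sum f ⟩
    sum f ≈⟨ ∑.sum-cong-≋ f≈g ⟩
    sum g ≈⟨ S≈sum g ⟨
    S g   ∎

  sum-zero : ∀ {f : Fin k → Carrier} → (∀ i → f i ≈ 0#) → S f ≈ 0#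
  sum-zero {k} {f} f≈0 = begin
    S f                  ≈⟨ S≈sum f ⟩
    sum f                ≈⟨ ∑.sum-cong-≋ f≈0 ⟩
    sum {k} (λ _ → 0#)   ≈⟨ ∑.sum-replicate-zero k ⟩
    0#                   ∎

  sum-distrib-+ : ∀ (f g : Fin k → Carrier) → S (λ i → f i + g i) ≈ S f + S g
  sum-distrib-+ f g = begin
    S (λ i → f i + g i) ≈⟨ S≈sum _ ⟩
    sum (λ i → f i + g i) ≈⟨ ∑.∑-distrib-+ f g ⟩
    sum f + sum g ≈⟨ +-cong (S≈sum f) (S≈sum g) ⟨
    S f + S g ∎

  sum-*ˡ : ∀ x (f : Fin k → Carrier) → S (λ i → x * f i) ≈ x * S f
  sum-*ˡ x f = begin
    S (λ i → x * f i)   ≈⟨ S≈sum _ ⟩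
    sum (λ i → x * f i) ≈⟨ ∑.*-distribˡ-sum x f ⟨
    x * sum f           ≈⟨ *-congˡ (S≈sum f) ⟨
    x * S f             ∎

  sum-*ʳ : ∀ x (f : Fin k → Carrier) → S (λ i → f i * x) ≈ S f * x
  sum-*ʳ x f = begin
    S (λ i → f i * x)   ≈⟨ S≈sum _ ⟩
    sum (λ i → f i * x) ≈⟨ ∑.*-distribʳ-sum x f ⟨
    sum f * x           ≈⟨ *-congʳ (S≈sum f) ⟨
    S f * x             ∎

  sum-neg : ∀ (f : Fin k → Carrier) → S (λ i → - f i) ≈ - S f
  sum-neg f = begin
    S (λ i → - f i)       ≈⟨ sum-cong (λ i → ≈-sym (-1*x≈-x (f i))) ⟩
    S (λ i → - 1# * f i)  ≈⟨ sum-*ˡ (- 1#) f ⟩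
    - 1# * S f            ≈⟨ -1*x≈-x (S f) ⟩
    - S f                 ∎

  sum-comm : ∀ {k m} (f : Fin k → Fin m → Carrier) →
             S (λ i → S (λ j → f i j)) ≈ S (λ j → S (λ i → f i j))
  sum-comm {k} {m} f = begin
    S (λ i → S (λ j → f i j))     ≈⟨ S≈sum _ ⟩
    sum (λ i → S (λ j → f i j))   ≈⟨ ∑.sum-cong-≋ (λ i → S≈sum (f i)) ⟩
    sum (λ i → sum {m} (λ j → f i j)) ≈⟨ ∑.∑-comm f ⟩
    sum (λ j → sum {k} (λ i → f i j)) ≈⟨ ∑.sum-cong-≋ (λ j → S≈sum (λ i → f i j)) ⟨
    sum (λ j → S (λ i → f i j))   ≈⟨ S≈sum _ ⟨
    S (λ j → S (λ i → f i j))     ∎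

  sum-init-last : ∀ (f : Fin (suc k) → Carrier) → S f ≈ S (f ∘ inject₁) + f (fromℕ k)
  sum-init-last f = begin
    S f                      ≈⟨ S≈sum f ⟩
    sum f                    ≈⟨ ∑.sum-init-last f ⟩
    sum (f ∘ inject₁) + _    ≈⟨ +-congʳ (S≈sum (f ∘ inject₁)) ⟨
    S (f ∘ inject₁) + _      ∎

  sum-single : ∀ (f : Fin k → Carrier) a → (∀ i → i ≢ a → f i ≈ 0#) → S f ≈ f a
  sum-single {suc k} f a f≈0 = begin
    S f                      ≈⟨ S≈sum f ⟩
    sum f                    ≈⟨ ∑.sum-remove {i = a} f ⟩
    f a + sum (f ∘ punchIn a) ≈⟨ +-congˡ (∑.sum-cong-≋ (λ i → f≈0 (punchIn a i) (punchInᵢ≢i a i))) ⟩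
    f a + sum {k} (λ _ → 0#) ≈⟨ +-congˡ (∑.sum-replicate-zero k) ⟩
    f a + 0#                 ≈⟨ +-identityʳ (f a) ⟩
    f a                      ∎

module ℤΣ = FinSum ℤ.+-*-commutativeRing sumℤ (λ _ → refl) (λ _ → refl)
module ℚΣ = FinSum ℚ.+-*-commutativeRing sumℚ (λ _ → refl) (λ _ → refl)

indicator : ∀ {A : Set} → Dec A → ℤ
indicator D = if does D then + 1 else + 0

indicator-yes : ∀ {A : Set} (D : Dec A) → A → indicator D ≡ + 1
indicator-yes (yes _) _ = refl
indicator-yes (no ¬a) a = ⊥-elim (¬a a)

indicator-no : ∀ {A : Set} (D : Dec A) → ¬ A → indicator D ≡ + 0
indicator-no (yes a) ¬a = ⊥-elim (¬a a)
indicator-no (no _) _ = refl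

indicator-sym : ∀ {n} (i j : Fin n) → indicator (i ≟ j) ≡ indicator (j ≟ i)
indicator-sym i j with i ≟ j
... | yes refl = ≡.sym (indicator-yes (i ≟ i) refl)
... | no i≢j = ≡.sym (indicator-no (j ≟ i) (i≢j ∘ ≡.sym))

indicator-inject₁ : ∀ {n} (i j : Fin n) → indicator (inject₁ i ≟ inject₁ j) ≡ idMat i j
indicator-inject₁ i j with i ≟ j
... | yes refl = indicator-yes (inject₁ i ≟ inject₁ i) refl
... | no i≢j = indicator-no (inject₁ i ≟ inject₁ j) (i≢j ∘ inject₁-injective)

sum-indicator : ∀ {n} (f : Fin n → ℤ) a → sumℤ (λ i → indicator (i ≟ a) ℤ.* f i) ≡ f a
sum-indicator f a = begin
  sumℤ (λ i → indicator (i ≟ a) ℤ.* f i)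
    ≡⟨ ℤΣ.sum-single _ a (λ i i≢a → cong (ℤ._* f i) (indicator-no (i ≟ a) i≢a)) ⟩
  indicator (a ≟ a) ℤ.* f a              ≡⟨ cong (ℤ._* f a) (indicator-yes (a ≟ a) refl) ⟩
  + 1 ℤ.* f a                            ≡⟨ ℤ.*-identityˡ (f a) ⟩
  f a                                    ∎
  where open ≡-Reasoning

indicator-× : ∀ {A B : Set} (D : Dec A) (E : Dec B) → indicator D ℤ.* indicator E ≡ indicator (D ×-dec E)
indicator-× (yes _) (yes _) = refl
indicator-× (yes _) (no _) = refl
indicator-× (no _) _ = refl

count-none : ∀ {n} {P : Fin n → Set} (P? : Decidable P) → (∀ k → ¬ P k) → sumℤ (λ k → indicator (P? k)) ≡ + 0
count-none P? none = ℤΣ.sum-zero (λ k → indicator-no (P? k) (none k))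

count-unique : ∀ {n} {P : Fin n → Set} (P? : Decidable P) a → P a → (∀ k → P k → k ≡ a) →
  sumℤ (λ k → indicator (P? k)) ≡ + 1
count-unique P? a pa unique =
  trans (ℤΣ.sum-single _ a (λ k k≢a → indicator-no (P? k) (k≢a ∘ unique k))) (indicator-yes (P? a) pa)

indicator-*-cong : ∀ {A : Set} (D : Dec A) {x y} → (A → x ≡ y) → indicator D ℤ.* x ≡ indicator D ℤ.* y
indicator-*-cong (yes a) x≡y = cong (+ 1 ℤ.*_) (x≡y a)
indicator-*-cong (no _) _ = refl

adjacency : ∀ {n} → Graph n → Fin n → Fin n → ℤ
adjacency G i k = if adj G i k then + 1 else + 0

adjacency≡indicator : ∀ {n} (G : Graph n) i k → adjacency G i k ≡ indicator (adj G i k Bool.≟ true)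
adjacency≡indicator G i k = bool (adj G i k)
  where
  bool : ∀ b → (if b then + 1 else + 0) ≡ indicator (b Bool.≟ true)
  bool true = refl
  bool false = refl

+-sumℕ : ∀ {k} (f : Fin k → ℕ) → + sumℕ f ≡ sumℤ (λ i → + f i)
+-sumℕ {zero} f = refl
+-sumℕ {suc k} f = trans (ℤ.pos-+ (f zero) (sumℕ (f ∘ suc))) (cong (ℤ._+_ (+ f zero)) (+-sumℕ (f ∘ suc)))

+-if : ∀ (b : Bool) → + (if b then 1 else 0) ≡ (if b then + 1 else + 0)
+-if true = refl
+-if false = refl

degree≡sum-adjacency : ∀ {n} (G : Graph n) i → + degree G i ≡ sumℤ (adjacency G i)
degree≡sum-adjacency G i =
  trans (+-sumℕ (λ k → if adj G i k then 1 else 0)) (ℤΣ.sum-cong (λ k → +-if (adj G i k)))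

adjacency-irrefl : ∀ {n} (G : Graph n) i → adjacency G i i ≡ + 0
adjacency-irrefl G i = cong (λ b → if b then + 1 else + 0) (irrefl G i)

laplacian≡degree-adjacency : ∀ {n} (G : Graph n) i k →
  laplacian G i k ≡ indicator (i ≟ k) ℤ.* + degree G i ℤ.- adjacency G i k
laplacian≡degree-adjacency G i k with i ≟ k
... | yes refl = trans (x≡1*x-0 (+ degree G i)) (cong (λ a → + 1 ℤ.* + degree G i ℤ.- a) (≡.sym (adjacency-irrefl G i)))
  where
  x≡1*x-0 : ∀ x → x ≡ + 1 ℤ.* x ℤ.- + 0
  x≡1*x-0 = solve-∀
... | no _ with adj G i k
...   | true = refl
...   | false = refl

laplacian-sym : ∀ {n} (G : Graph n) i k → laplacian G i k ≡ laplacian G k i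
laplacian-sym G i k with i ≟ k | k ≟ i
... | yes refl | yes _ = refl
... | yes i≡k | no k≢i = ⊥-elim (k≢i (≡.sym i≡k))
... | no i≢k | yes k≡i = ⊥-elim (i≢k (≡.sym k≡i))
... | no _ | no _ rewrite Graph.sym G i k = refl

laplacian-rowsum : ∀ {n} (G : Graph n) i → sumℤ (laplacian G i) ≡ + 0
laplacian-rowsum G i = begin
  sumℤ (laplacian G i)
    ≡⟨ ℤΣ.sum-cong (laplacian≡degree-adjacency G i) ⟩
  sumℤ (λ k → indicator (i ≟ k) ℤ.* + degree G i ℤ.- adjacency G i k)
    ≡⟨ ℤΣ.sum-distrib-+ (λ k → indicator (i ≟ k) ℤ.* + degree G i) (λ k → ℤ.- adjacency G i k) ⟩
  sumℤ (λ k → indicator (i ≟ k) ℤ.* + degree G i) ℤ.+ sumℤ (λ k → ℤ.- adjacency G i k)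
    ≡⟨ cong₂ ℤ._+_ degree-term (ℤΣ.sum-neg (adjacency G i)) ⟩
  + degree G i ℤ.- sumℤ (adjacency G i)
    ≡⟨ cong (λ s → + degree G i ℤ.- s) (degree≡sum-adjacency G i) ⟨
  + degree G i ℤ.- + degree G i
    ≡⟨ ℤ.+-inverseʳ (+ degree G i) ⟩
  + 0 ∎
  where
  open ≡-Reasoning
  degree-term : sumℤ (λ k → indicator (i ≟ k) ℤ.* + degree G i) ≡ + degree G i
  degree-term = trans (ℤΣ.sum-cong (λ k → cong (ℤ._* + degree G i) (indicator-sym i k)))
                      (sum-indicator (λ _ → + degree G i) i)

laplacian-colsum : ∀ {n} (G : Graph n) k → sumℤ (λ i → laplacian G i k) ≡ + 0
laplacian-colsum G k = trans (ℤΣ.sum-cong (λ i → laplacian-sym G i k)) (laplacian-rowsum G k)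

laplacian-apply : ∀ {n} (G : Graph n) (w : Fin n → ℤ) i →
  sumℤ (λ k → laplacian G i k ℤ.* w k) ≡ sumℤ (λ k → adjacency G i k ℤ.* (w i ℤ.- w k))
laplacian-apply G w i = begin
  sumℤ (λ k → laplacian G i k ℤ.* w k)
    ≡⟨ ℤΣ.sum-cong split ⟩
  sumℤ (λ k → laplacian G i k ℤ.* w i ℤ.+ adjacency G i k ℤ.* (w i ℤ.- w k))
    ≡⟨ ℤΣ.sum-distrib-+ (λ k → laplacian G i k ℤ.* w i) (λ k → adjacency G i k ℤ.* (w i ℤ.- w k)) ⟩
  sumℤ (λ k → laplacian G i k ℤ.* w i) ℤ.+ sumℤ (λ k → adjacency G i k ℤ.* (w i ℤ.- w k))
    ≡⟨ cong (ℤ._+ sumℤ (λ k → adjacency G i k ℤ.* (w i ℤ.- w k))) (ℤΣ.sum-*ʳ (w i) (laplacian G i)) ⟩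
  sumℤ (laplacian G i) ℤ.* w i ℤ.+ sumℤ (λ k → adjacency G i k ℤ.* (w i ℤ.- w k))
    ≡⟨ cong (λ s → s ℤ.* w i ℤ.+ sumℤ (λ k → adjacency G i k ℤ.* (w i ℤ.- w k))) (laplacian-rowsum G i) ⟩
  + 0 ℤ.* w i ℤ.+ sumℤ (λ k → adjacency G i k ℤ.* (w i ℤ.- w k))
    ≡⟨ ℤ.+-identityˡ _ ⟩
  sumℤ (λ k → adjacency G i k ℤ.* (w i ℤ.- w k)) ∎
  where
  open ≡-Reasoning
  diagonal : ∀ a x → a ℤ.* x ≡ a ℤ.* x ℤ.+ + 0 ℤ.* (x ℤ.- x)
  diagonal = solve-∀
  off-diagonal : ∀ a x y → (ℤ.- a) ℤ.* y ≡ (ℤ.- a) ℤ.* x ℤ.+ a ℤ.* (x ℤ.- y)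
  off-diagonal = solve-∀
  split : ∀ k → laplacian G i k ℤ.* w k ≡ laplacian G i k ℤ.* w i ℤ.+ adjacency G i k ℤ.* (w i ℤ.- w k)
  split k with i ≟ k
  ... | yes refl rewrite adjacency-irrefl G i = diagonal (+ degree G i) (w i)
  ... | no _ with adj G i k
  ...   | true = off-diagonal (+ 1) (w i) (w k)
  ...   | false = off-diagonal (+ 0) (w i) (w k)

degree-complete : ∀ d a → + degree (complete (suc d)) a ≡ + d
degree-complete d a = begin
  + degree (complete (suc d)) a              ≡⟨ degree≡sum-adjacency (complete (suc d)) a ⟩
  sumℤ (adjacency (complete (suc d)) a)      ≡⟨ ℤΣ.sum-cong non-loop ⟩
  sumℤ (λ j → + 1 ℤ.+ ℤ.- indicator (j ≟ a)) ≡⟨ ℤΣ.sum-distrib-+ (λ _ → + 1) (λ j → ℤ.- indicator (j ≟ a)) ⟩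
  sumℤ {suc d} (λ _ → + 1) ℤ.+ sumℤ (λ j → ℤ.- indicator (j ≟ a))
    ≡⟨ cong₂ ℤ._+_ (sum-one (suc d)) (trans (ℤΣ.sum-neg (λ j → indicator (j ≟ a))) (cong ℤ.-_ loop)) ⟩
  + suc d ℤ.- + 1                            ≡⟨⟩
  + d                                        ∎
  where
  open ≡-Reasoning
  non-loop : ∀ j → adjacency (complete (suc d)) a j ≡ + 1 ℤ.+ ℤ.- indicator (j ≟ a)
  non-loop j with a ≟ j | j ≟ a
  ... | yes _ | yes _ = refl
  ... | no _ | no _ = refl
  ... | yes a≡j | no j≢a = ⊥-elim (j≢a (≡.sym a≡j))
  ... | no a≢j | yes j≡a = ⊥-elim (a≢j (≡.sym j≡a))
  sum-one : ∀ k → sumℤ {k} (λ _ → + 1) ≡ + k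
  sum-one zero = refl
  sum-one (suc k) = cong (ℤ._+_ (+ 1)) (sum-one k)
  loop : sumℤ (λ j → indicator (j ≟ a)) ≡ + 1
  loop = count-unique (_≟ a) a refl (λ _ j≡a → j≡a)

laplacian-complete : ∀ d a c →
  laplacian (complete (suc d)) a c ≡ + suc d ℤ.* indicator (a ≟ c) ℤ.- + 1
laplacian-complete d a c with a ≟ c
... | yes refl = trans (degree-complete d a) (n≡[1+n]*1-1 (+ d))
  where
  n≡[1+n]*1-1 : ∀ n → n ≡ (+ 1 ℤ.+ n) ℤ.* + 1 ℤ.- + 1
  n≡[1+n]*1-1 = solve-∀
... | no _ = cong (ℤ._- + 1) (≡.sym (ℤ.*-zeroʳ (+ suc d)))

toℚᵘ-toℚ : ∀ z → ℚ.toℚᵘ (toℚ z) ℚᵘ.≃ ℚᵘ.mkℚᵘ z 0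
toℚᵘ-toℚ z = ℚ.toℚᵘ-fromℚᵘ (ℚᵘ.mkℚᵘ z 0)

toℚ-+ : ∀ a b → toℚ (a ℤ.+ b) ≡ toℚ a ℚ.+ toℚ b
toℚ-+ a b = ℚ.toℚᵘ-injective (ℚᵘ.≃-trans (toℚᵘ-toℚ (a ℤ.+ b))
  (ℚᵘ.≃-sym (ℚᵘ.≃-trans (ℚ.toℚᵘ-homo-+ (toℚ a) (toℚ b))
    (ℚᵘ.≃-trans (ℚᵘ.+-cong (toℚᵘ-toℚ a) (toℚᵘ-toℚ b))
      (ℚᵘ.*≡* (cong₂ (λ u v → (u ℤ.+ v) ℤ.* + 1) (ℤ.*-identityʳ a) (ℤ.*-identityʳ b)))))))

toℚ-* : ∀ a b → toℚ (a ℤ.* b) ≡ toℚ a ℚ.* toℚ b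
toℚ-* a b = ℚ.toℚᵘ-injective (ℚᵘ.≃-trans (toℚᵘ-toℚ (a ℤ.* b))
  (ℚᵘ.≃-sym (ℚᵘ.≃-trans (ℚ.toℚᵘ-homo-* (toℚ a) (toℚ b))
    (ℚᵘ.≃-trans (ℚᵘ.*-cong (toℚᵘ-toℚ a) (toℚᵘ-toℚ b)) (ℚᵘ.*≡* refl)))))

toℚ-neg : ∀ a → toℚ (ℤ.- a) ≡ ℚ.- toℚ a
toℚ-neg a = ℚ.toℚᵘ-injective (ℚᵘ.≃-trans (toℚᵘ-toℚ (ℤ.- a))
  (ℚᵘ.≃-sym (ℚᵘ.≃-trans (ℚ.toℚᵘ-homo‿- (toℚ a))
    (ℚᵘ.≃-trans (ℚᵘ.-‿cong (toℚᵘ-toℚ a)) (ℚᵘ.*≡* refl)))))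

toℚ-- : ∀ a b → toℚ (a ℤ.- b) ≡ toℚ a ℚ.- toℚ b
toℚ-- a b = trans (toℚ-+ a (ℤ.- b)) (cong (toℚ a ℚ.+_) (toℚ-neg b))

toℚ-sum : ∀ {k} (f : Fin k → ℤ) → toℚ (sumℤ f) ≡ sumℚ (toℚ ∘ f)
toℚ-sum {zero} f = refl
toℚ-sum {suc k} f = trans (toℚ-+ (f zero) _) (cong (toℚ (f zero) ℚ.+_) (toℚ-sum (f ∘ suc)))

toℚ-nonNeg : ∀ k → 0ℚ ℚ.≤ toℚ (+ k)
toℚ-nonNeg k = ℚ.nonNegative⁻¹ (toℚ (+ k)) {{ℚ.normalize-nonNeg k 1}}

indicator-nonNeg : ∀ {A : Set} (D : Dec A) → 0ℚ ℚ.≤ toℚ (indicator D)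
indicator-nonNeg (yes _) = toℚ-nonNeg 1
indicator-nonNeg (no _) = toℚ-nonNeg 0

δ : ∀ {k} → Fin k → Fin k → ℚ
δ i a = toℚ (indicator (i ≟ a))

*-nonNeg : ∀ {p q} → 0ℚ ℚ.≤ p → 0ℚ ℚ.≤ q → 0ℚ ℚ.≤ p ℚ.* q
*-nonNeg {p} {q} 0≤p 0≤q = ℚ.nonNegative⁻¹ (p ℚ.* q)
  {{ℚ.nonNeg*nonNeg⇒nonNeg p {{ℚ.nonNegative 0≤p}} q {{ℚ.nonNegative 0≤q}}}}

p≤q⇒0≤q-p : ∀ {p q} → p ℚ.≤ q → 0ℚ ℚ.≤ q ℚ.- p
p≤q⇒0≤q-p {p} {q} p≤q = subst (ℚ._≤ q ℚ.- p) (ℚ.+-inverseʳ p) (ℚ.+-monoˡ-≤ (ℚ.- p) p≤q)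

0≤p⇒1-p≤1 : ∀ {p} → 0ℚ ℚ.≤ p → 1ℚ ℚ.- p ℚ.≤ 1ℚ
0≤p⇒1-p≤1 {p} 0≤p = subst (1ℚ ℚ.- p ℚ.≤_) (ℚ.+-identityʳ 1ℚ) (ℚ.+-monoʳ-≤ 1ℚ (ℚ.neg-antimono-≤ 0≤p))

sumℚ-mono : ∀ {k} {f g : Fin k → ℚ} → (∀ i → f i ℚ.≤ g i) → sumℚ f ℚ.≤ sumℚ g
sumℚ-mono {zero} f≤g = ℚ.≤-refl
sumℚ-mono {suc k} f≤g = ℚ.+-mono-≤ (f≤g zero) (sumℚ-mono (f≤g ∘ suc))

sum-const : ∀ {k} c → sumℚ {k} (λ _ → c) ≡ toℚ (+ k) ℚ.* c
sum-const {zero} c = ≡.sym (ℚ.*-zeroˡ c)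
sum-const {suc k} c = begin
  c ℚ.+ sumℚ {k} (λ _ → c)          ≡⟨ cong₂ ℚ._+_ (≡.sym (ℚ.*-identityˡ c)) (sum-const {k} c) ⟩
  1ℚ ℚ.* c ℚ.+ toℚ (+ k) ℚ.* c      ≡⟨ ℚ.*-distribʳ-+ c 1ℚ (toℚ (+ k)) ⟨
  (1ℚ ℚ.+ toℚ (+ k)) ℚ.* c          ≡⟨ cong (ℚ._* c) (toℚ-+ (+ 1) (+ k)) ⟨
  toℚ (+ suc k) ℚ.* c               ∎
  where open ≡-Reasoning

sum-*-δ : ∀ {k} (f : Fin k → ℚ) a → sumℚ (λ i → f i ℚ.* δ i a) ≡ f a
sum-*-δ f a = begin
  sumℚ (λ i → f i ℚ.* δ i a)
    ≡⟨ ℚΣ.sum-single _ a (λ i i≢a →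
         trans (cong (λ t → f i ℚ.* toℚ t) (indicator-no (i ≟ a) i≢a)) (ℚ.*-zeroʳ (f i))) ⟩
  f a ℚ.* δ a a
    ≡⟨ cong (λ t → f a ℚ.* toℚ t) (indicator-yes (a ≟ a) refl) ⟩
  f a ℚ.* 1ℚ
    ≡⟨ ℚ.*-identityʳ (f a) ⟩
  f a ∎
  where open ≡-Reasoning

dot-comm : ∀ {d} (x y : Pt d) → dot x y ≡ dot y x
dot-comm x y = ℚΣ.sum-cong (λ j → ℚ.*-comm (x j) (y j))

dot-combination : ∀ {k d} (ν : Fin k → ℚ) (v : Fin k → Pt d) (y c : Pt d) →
  (∀ m → y m ≡ sumℚ (λ i → ν i ℚ.* v i m)) → dot y c ≡ sumℚ (λ i → ν i ℚ.* dot (v i) c)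
dot-combination ν v y c y≡ = begin
  sumℚ (λ m → y m ℚ.* c m)
    ≡⟨ ℚΣ.sum-cong (λ m → trans (cong (ℚ._* c m) (y≡ m))
                                (≡.sym (ℚΣ.sum-*ʳ (c m) (λ i → ν i ℚ.* v i m)))) ⟩
  sumℚ (λ m → sumℚ (λ i → ν i ℚ.* v i m ℚ.* c m))
    ≡⟨ ℚΣ.sum-comm (λ m i → ν i ℚ.* v i m ℚ.* c m) ⟩
  sumℚ (λ i → sumℚ (λ m → ν i ℚ.* v i m ℚ.* c m))
    ≡⟨ ℚΣ.sum-cong (λ i → trans (ℚΣ.sum-cong (λ m → ℚ.*-assoc (ν i) (v i m) (c m)))
                                (ℚΣ.sum-*ˡ (ν i) (λ m → v i m ℚ.* c m))) ⟩
  sumℚ (λ i → ν i ℚ.* dot (v i) c) ∎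
  where open ≡-Reasoning

-- Graphs with a unimodular reduced Laplacian

reducedLaplacian : ∀ {d} → Graph (suc d) → Mat d
reducedLaplacian G m j = laplacian G (inject₁ m) (inject₁ j)

laplacian-last-row : ∀ {d} (G : Graph (suc d)) m →
  laplacian G (fromℕ d) (inject₁ m) ≡ ℤ.- sumℤ (λ a → reducedLaplacian G a m)
laplacian-last-row G m = inverseʳ-unique _ _
  (trans (≡.sym (ℤΣ.sum-init-last (λ i → laplacian G i (inject₁ m)))) (laplacian-colsum G (inject₁ m)))

negate : ∀ {d} → Mat d → Mat d
negate A i j = ℤ.- A i j

-x*-y≡x*y : ∀ x y → ℤ.- x ℤ.* ℤ.- y ≡ x ℤ.* y
-x*-y≡x*y = solve-∀

negate-⊗ : ∀ {d} (A B : Mat d) i j → (negate A ⊗ negate B) i j ≡ (A ⊗ B) i j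
negate-⊗ A B i j = ℤΣ.sum-cong (λ k → -x*-y≡x*y (A i k) (B k j))

negate-unimodular : ∀ {d} {A : Mat d} → IsUnimodular A → IsUnimodular (negate A)
negate-unimodular {A = A} (B , AB≡I , BA≡I) =
  negate B , (λ i j → trans (negate-⊗ A B i j) (AB≡I i j)) , (λ i j → trans (negate-⊗ B A i j) (BA≡I i j))

laplacianVertex-image : ∀ {d} (G : Graph (suc d)) (W : Mat d) →
  (∀ m j → (reducedLaplacian G ⊗ W) m j ≡ idMat m j) →
  ∀ i j → sumℤ (λ m → laplacian G i (inject₁ m) ℤ.* negate W m j)
          ≡ indicator (i ≟ fromℕ d) ℤ.- indicator (i ≟ inject₁ j)
laplacianVertex-image {d} G W LW≡I i j with view i
... | ‵inject₁ a = begin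
  sumℤ (λ m → laplacian G (inject₁ a) (inject₁ m) ℤ.* ℤ.- W m j)
    ≡⟨ ℤΣ.sum-cong (λ m → ≡.sym (ℤ.neg-distribʳ-* (laplacian G (inject₁ a) (inject₁ m)) (W m j))) ⟩
  sumℤ (λ m → ℤ.- (reducedLaplacian G a m ℤ.* W m j))
    ≡⟨ ℤΣ.sum-neg (λ m → reducedLaplacian G a m ℤ.* W m j) ⟩
  ℤ.- (reducedLaplacian G ⊗ W) a j
    ≡⟨ cong ℤ.-_ (trans (LW≡I a j) (≡.sym (indicator-inject₁ a j))) ⟩
  ℤ.- indicator (inject₁ a ≟ inject₁ j)
    ≡⟨ ℤ.+-identityˡ _ ⟨
  + 0 ℤ.- indicator (inject₁ a ≟ inject₁ j)
    ≡⟨ cong (ℤ._- indicator (inject₁ a ≟ inject₁ j))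
            (≡.sym (indicator-no (inject₁ a ≟ fromℕ d) (fromℕ≢inject₁ ∘ ≡.sym))) ⟩
  indicator (inject₁ a ≟ fromℕ d) ℤ.- indicator (inject₁ a ≟ inject₁ j) ∎
  where open ≡-Reasoning
... | ‵fromℕ = begin
  sumℤ (λ m → laplacian G (fromℕ d) (inject₁ m) ℤ.* ℤ.- W m j)
    ≡⟨ ℤΣ.sum-cong (λ m → cong (ℤ._* ℤ.- W m j) (laplacian-last-row G m)) ⟩
  sumℤ (λ m → ℤ.- sumℤ (λ a → reducedLaplacian G a m) ℤ.* ℤ.- W m j)
    ≡⟨ ℤΣ.sum-cong (λ m → -x*-y≡x*y (sumℤ (λ a → reducedLaplacian G a m)) (W m j)) ⟩
  sumℤ (λ m → sumℤ (λ a → reducedLaplacian G a m) ℤ.* W m j)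
    ≡⟨ ℤΣ.sum-cong (λ m → ≡.sym (ℤΣ.sum-*ʳ (W m j) (λ a → reducedLaplacian G a m))) ⟩
  sumℤ (λ m → sumℤ (λ a → reducedLaplacian G a m ℤ.* W m j))
    ≡⟨ ℤΣ.sum-comm (λ m a → reducedLaplacian G a m ℤ.* W m j) ⟩
  sumℤ (λ a → (reducedLaplacian G ⊗ W) a j)
    ≡⟨ ℤΣ.sum-cong (λ a → trans (LW≡I a j) (≡.sym (ℤ.*-identityʳ _))) ⟩
  sumℤ (λ a → indicator (a ≟ j) ℤ.* + 1)
    ≡⟨ sum-indicator (λ _ → + 1) j ⟩
  + 1 ℤ.- + 0
    ≡⟨ cong (ℤ._-_ (+ 1)) (≡.sym (indicator-no (fromℕ d ≟ inject₁ j) fromℕ≢inject₁)) ⟩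
  + 1 ℤ.- indicator (fromℕ d ≟ inject₁ j)
    ≡⟨ cong (ℤ._- indicator (fromℕ d ≟ inject₁ j)) (≡.sym (indicator-yes (fromℕ d ≟ fromℕ d) refl)) ⟩
  indicator (fromℕ d ≟ fromℕ d) ℤ.- indicator (fromℕ d ≟ inject₁ j) ∎
  where open ≡-Reasoning

laplacianVertex-complete : ∀ d a m →
  laplacianVertex (complete (suc d)) a m ≡ toℚ (+ suc d) ℚ.* δ a (inject₁ m) ℚ.- 1ℚ
laplacianVertex-complete d a m = begin
  toℚ (laplacian (complete (suc d)) a (inject₁ m))
    ≡⟨ cong toℚ (laplacian-complete d a (inject₁ m)) ⟩
  toℚ (+ suc d ℤ.* indicator (a ≟ inject₁ m) ℤ.- + 1)
    ≡⟨ toℚ-- (+ suc d ℤ.* indicator (a ≟ inject₁ m)) (+ 1) ⟩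
  toℚ (+ suc d ℤ.* indicator (a ≟ inject₁ m)) ℚ.- 1ℚ
    ≡⟨ cong (ℚ._- 1ℚ) (toℚ-* (+ suc d) (indicator (a ≟ inject₁ m))) ⟩
  toℚ (+ suc d) ℚ.* δ a (inject₁ m) ℚ.- 1ℚ ∎
  where open ≡-Reasoning

laplacianVertex-inLaplacianSimplex : ∀ {d} (G : Graph (suc d)) a → InLaplacianSimplex G (laplacianVertex G a)
laplacianVertex-inLaplacianSimplex G a =
  (λ i → δ i a) ,
  (λ i → indicator-nonNeg (i ≟ a)) ,
  trans (ℚΣ.sum-cong (λ i → ≡.sym (ℚ.*-identityˡ (δ i a))))
        (sum-*-δ (λ _ → 1ℚ) a) ,
  (λ j → ≡.sym (trans (ℚΣ.sum-cong (λ i → ℚ.*-comm (δ i a) (laplacianVertex G i j)))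
                      (sum-*-δ (λ i → laplacianVertex G i j) a)))

-- The point (x₁, …, x_d, 0) ∈ ℚⁿ.
zeroExtend : ∀ {d} → Pt d → Fin (suc d) → ℚ
zeroExtend x a = sumℚ (λ m → x m ℚ.* δ a (inject₁ m))

zeroExtend-inject₁ : ∀ {d} (x : Pt d) j → zeroExtend x (inject₁ j) ≡ x j
zeroExtend-inject₁ x j = trans
  (ℚΣ.sum-cong (λ m → cong (λ t → x m ℚ.* toℚ t) (trans (indicator-inject₁ j m) (indicator-sym j m))))
  (sum-*-δ x j)

zeroExtend-fromℕ : ∀ {d} (x : Pt d) → zeroExtend x (fromℕ d) ≡ 0ℚ
zeroExtend-fromℕ x = ℚΣ.sum-zero (λ m →
  trans (cong (λ t → x m ℚ.* toℚ t) (indicator-no (_ ≟ inject₁ m) fromℕ≢inject₁)) (ℚ.*-zeroʳ (x m)))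

sum-zeroExtend : ∀ {d} (x : Pt d) → sumℚ (zeroExtend x) ≡ sumℚ x
sum-zeroExtend x = trans (ℚΣ.sum-init-last (zeroExtend x))
  (trans (cong₂ ℚ._+_ (ℚΣ.sum-cong (zeroExtend-inject₁ x)) (zeroExtend-fromℕ x)) (ℚ.+-identityʳ (sumℚ x)))

dot-laplacianVertex-complete : ∀ {d} (x : Pt d) a →
  dot x (laplacianVertex (complete (suc d)) a) ≡ toℚ (+ suc d) ℚ.* zeroExtend x a ℚ.- sumℚ x
dot-laplacianVertex-complete {d} x a = begin
  sumℚ (λ m → x m ℚ.* laplacianVertex (complete (suc d)) a m)
    ≡⟨ ℚΣ.sum-cong (λ m → trans (cong (x m ℚ.*_) (laplacianVertex-complete d a m)) (expand (x m) (e m))) ⟩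
  sumℚ (λ m → n ℚ.* (x m ℚ.* e m) ℚ.+ ℚ.- x m)
    ≡⟨ ℚΣ.sum-distrib-+ (λ m → n ℚ.* (x m ℚ.* e m)) (λ m → ℚ.- x m) ⟩
  sumℚ (λ m → n ℚ.* (x m ℚ.* e m)) ℚ.+ sumℚ (λ m → ℚ.- x m)
    ≡⟨ cong₂ ℚ._+_ (ℚΣ.sum-*ˡ n (λ m → x m ℚ.* e m)) (ℚΣ.sum-neg x) ⟩
  n ℚ.* zeroExtend x a ℚ.- sumℚ x ∎
  where
  open ≡-Reasoning
  n : ℚ
  n = toℚ (+ suc d)
  e : Fin d → ℚ
  e m = δ a (inject₁ m)
  expand : ∀ x e → x ℚ.* (n ℚ.* e ℚ.- 1ℚ) ≡ n ℚ.* (x ℚ.* e) ℚ.+ ℚ.- x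
  expand = solve 3 (λ n x e → x :* (n :* e :- con 1ℚ) := n :* (x :* e) :+ (:- x)) refl n

module LaplacianSimplexImage {d : ℕ} (G : Graph (suc d)) (W : Mat d)
  (LW≡I : ∀ m j → (reducedLaplacian G ⊗ W) m j ≡ idMat m j) where


  K : Graph (suc d)
  K = complete (suc d)

  n : ℚ
  n = toℚ (+ suc d)

  origin : Fin d → ℤ
  origin _ = + 0

  image : Pt d → Pt d
  image = affine (negate W) origin

  column : Fin d → Pt d
  column j m = toℚ (negate W m j)

  vertex-image : ∀ i j → dot (laplacianVertex G i) (column j) ≡ δ i (fromℕ d) ℚ.- δ i (inject₁ j)
  vertex-image i j = begin
    sumℚ (λ m → toℚ (laplacian G i (inject₁ m)) ℚ.* toℚ (negate W m j))
      ≡⟨ ℚΣ.sum-cong (λ m → toℚ-* (laplacian G i (inject₁ m)) (negate W m j)) ⟨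
    sumℚ (λ m → toℚ (laplacian G i (inject₁ m) ℤ.* negate W m j))
      ≡⟨ toℚ-sum (λ m → laplacian G i (inject₁ m) ℤ.* negate W m j) ⟨
    toℚ (sumℤ (λ m → laplacian G i (inject₁ m) ℤ.* negate W m j))
      ≡⟨ cong toℚ (laplacianVertex-image G W LW≡I i j) ⟩
    toℚ (indicator (i ≟ fromℕ d) ℤ.- indicator (i ≟ inject₁ j))
      ≡⟨ toℚ-- (indicator (i ≟ fromℕ d)) (indicator (i ≟ inject₁ j)) ⟩
    δ i (fromℕ d) ℚ.- δ i (inject₁ j) ∎
    where open ≡-Reasoning

  image-convex : ∀ (λs : Fin (suc d) → ℚ) y → (∀ m → y m ≡ sumℚ (λ i → λs i ℚ.* laplacianVertex G i m)) →
    ∀ j → image y j ≡ λs (fromℕ d) ℚ.- λs (inject₁ j)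
  image-convex λs y y≡ j = begin
    dot y (column j) ℚ.+ 0ℚ
      ≡⟨ ℚ.+-identityʳ _ ⟩
    dot y (column j)
      ≡⟨ dot-combination λs (laplacianVertex G) y (column j) y≡ ⟩
    sumℚ (λ i → λs i ℚ.* dot (laplacianVertex G i) (column j))
      ≡⟨ ℚΣ.sum-cong (λ i → trans (cong (λs i ℚ.*_) (vertex-image i j))
                                  (ℚ.*-distribˡ-+ (λs i) (δ i (fromℕ d)) (ℚ.- δ i (inject₁ j)))) ⟩
    sumℚ (λ i → λs i ℚ.* δ i (fromℕ d) ℚ.+ λs i ℚ.* ℚ.- δ i (inject₁ j))
      ≡⟨ ℚΣ.sum-distrib-+ (λ i → λs i ℚ.* δ i (fromℕ d)) (λ i → λs i ℚ.* ℚ.- δ i (inject₁ j)) ⟩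
    sumℚ (λ i → λs i ℚ.* δ i (fromℕ d)) ℚ.+ sumℚ (λ i → λs i ℚ.* ℚ.- δ i (inject₁ j))
      ≡⟨ cong₂ ℚ._+_ (sum-*-δ λs (fromℕ d)) negative-part ⟩
    λs (fromℕ d) ℚ.- λs (inject₁ j) ∎
    where
    open ≡-Reasoning
    negative-part : sumℚ (λ i → λs i ℚ.* ℚ.- δ i (inject₁ j)) ≡ ℚ.- λs (inject₁ j)
    negative-part = trans (ℚΣ.sum-cong (λ i → ≡.sym (ℚ.neg-distribʳ-* (λs i) (δ i (inject₁ j)))))
      (trans (ℚΣ.sum-neg (λ i → λs i ℚ.* δ i (inject₁ j))) (cong ℚ.-_ (sum-*-δ λs (inject₁ j))))

  module Forward (λs : Fin (suc d) → ℚ) (λs≥0 : ∀ i → 0ℚ ℚ.≤ λs i) (Σλs≡1 : sumℚ λs ≡ 1ℚ)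
    (y : Pt d) (y≡ : ∀ m → y m ≡ sumℚ (λ i → λs i ℚ.* laplacianVertex G i m)) where

    zeroExtend-image : ∀ a → zeroExtend (image y) a ≡ λs (fromℕ d) ℚ.- λs a
    zeroExtend-image a with view a
    ... | ‵inject₁ j = trans (zeroExtend-inject₁ (image y) j) (image-convex λs y y≡ j)
    ... | ‵fromℕ = trans (zeroExtend-fromℕ (image y)) (≡.sym (ℚ.+-inverseʳ (λs (fromℕ d))))

    sum-image : sumℚ (image y) ≡ n ℚ.* λs (fromℕ d) ℚ.- 1ℚ
    sum-image = begin
      sumℚ (image y)                                    ≡⟨ sum-zeroExtend (image y) ⟨
      sumℚ (zeroExtend (image y))                       ≡⟨ ℚΣ.sum-cong zeroExtend-image ⟩
      sumℚ (λ a → λs (fromℕ d) ℚ.+ ℚ.- λs a)            ≡⟨ ℚΣ.sum-distrib-+ (λ _ → λs (fromℕ d)) (λ a → ℚ.- λs a) ⟩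
      sumℚ {suc d} (λ _ → λs (fromℕ d)) ℚ.+ sumℚ (λ a → ℚ.- λs a)
        ≡⟨ cong₂ ℚ._+_ (sum-const {suc d} (λs (fromℕ d))) (trans (ℚΣ.sum-neg λs) (cong ℚ.-_ Σλs≡1)) ⟩
      n ℚ.* λs (fromℕ d) ℚ.- 1ℚ                         ∎
      where open ≡-Reasoning

    image-pairing : ∀ a → dot (image y) (laplacianVertex K a) ≡ 1ℚ ℚ.- n ℚ.* λs a
    image-pairing a = begin
      dot (image y) (laplacianVertex K a)
        ≡⟨ dot-laplacianVertex-complete (image y) a ⟩
      n ℚ.* zeroExtend (image y) a ℚ.- sumℚ (image y)
        ≡⟨ cong₂ (λ e s → n ℚ.* e ℚ.- s) (zeroExtend-image a) sum-image ⟩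
      n ℚ.* (λs (fromℕ d) ℚ.- λs a) ℚ.- (n ℚ.* λs (fromℕ d) ℚ.- 1ℚ)
        ≡⟨ telescope n (λs (fromℕ d)) (λs a) ⟩
      1ℚ ℚ.- n ℚ.* λs a ∎
      where
      open ≡-Reasoning
      telescope : ∀ n r a → n ℚ.* (r ℚ.- a) ℚ.- (n ℚ.* r ℚ.- 1ℚ) ≡ 1ℚ ℚ.- n ℚ.* a
      telescope = solve 3 (λ n r a → n :* (r :- a) :- (n :* r :- con 1ℚ) := con 1ℚ :- n :* a) refl

    image-inDual : InDual (InLaplacianSimplex K) (image y)
    image-inDual y′ (ν , ν≥0 , Σν≡1 , y′≡) = begin
      dot (image y) y′
        ≡⟨ dot-comm (image y) y′ ⟩
      dot y′ (image y)
        ≡⟨ dot-combination ν (laplacianVertex K) y′ (image y) y′≡ ⟩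
      sumℚ (λ a → ν a ℚ.* dot (laplacianVertex K a) (image y))
        ≡⟨ ℚΣ.sum-cong (λ a → cong (ν a ℚ.*_) (trans (dot-comm (laplacianVertex K a) (image y)) (image-pairing a))) ⟩
      sumℚ (λ a → ν a ℚ.* (1ℚ ℚ.- n ℚ.* λs a))
        ≤⟨ sumℚ-mono (λ a → ℚ.*-monoˡ-≤-nonNeg (ν a) {{ℚ.nonNegative (ν≥0 a)}}
                              (0≤p⇒1-p≤1 (*-nonNeg (toℚ-nonNeg (suc d)) (λs≥0 a)))) ⟩
      sumℚ (λ a → ν a ℚ.* 1ℚ)
        ≡⟨ ℚΣ.sum-cong (λ a → ℚ.*-identityʳ (ν a)) ⟩
      sumℚ ν
        ≡⟨ Σν≡1 ⟩
      1ℚ ∎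
      where open ℚ.≤-Reasoning

  instance
    n-nonZero : ℚ.NonZero n
    n-nonZero = ℚ.pos⇒nonZero n {{ℚ.normalize-pos (suc d) 1}}

  1/n≥0 : 0ℚ ℚ.≤ ℚ.1/ n
  1/n≥0 = ℚ.nonNegative⁻¹ (ℚ.1/ n)
    {{ℚ.pos⇒nonNeg (ℚ.1/ n) {{ℚ.1/pos⇒pos n {{ℚ.normalize-pos (suc d) 1}}}}}}

  -- x = image y for the point y of 𝒫_G with barycentric coordinates
  -- μₐ = (1 + Σx)/n − xₐ (where x_n = 0); μ ≥ 0 is exactly the dual condition.
  module Backward (x : Pt d) (x∈dual : InDual (InLaplacianSimplex K) x) where

    s : ℚ
    s = sumℚ x

    μ : Fin (suc d) → ℚ
    μ a = ℚ.1/ n ℚ.* (1ℚ ℚ.+ s) ℚ.- zeroExtend x a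

    μ≥0 : ∀ a → 0ℚ ℚ.≤ μ a
    μ≥0 a = subst (0ℚ ℚ.≤_) rescale (*-nonNeg 1/n≥0 slack)
      where
      pairing≤1 : n ℚ.* zeroExtend x a ℚ.- s ℚ.≤ 1ℚ
      pairing≤1 = subst (ℚ._≤ 1ℚ) (dot-laplacianVertex-complete x a)
        (x∈dual (laplacianVertex K a) (laplacianVertex-inLaplacianSimplex K a))
      rearrange : ∀ s t → 1ℚ ℚ.- (t ℚ.- s) ≡ 1ℚ ℚ.+ s ℚ.- t
      rearrange = solve 2 (λ s t → con 1ℚ :- (t :- s) := con 1ℚ :+ s :- t) refl
      slack : 0ℚ ℚ.≤ 1ℚ ℚ.+ s ℚ.- n ℚ.* zeroExtend x a
      slack = subst (0ℚ ℚ.≤_) (rearrange s (n ℚ.* zeroExtend x a)) (p≤q⇒0≤q-p pairing≤1)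
      distribute : ∀ q s n e → q ℚ.* (1ℚ ℚ.+ s ℚ.- n ℚ.* e) ≡ q ℚ.* (1ℚ ℚ.+ s) ℚ.- (q ℚ.* n) ℚ.* e
      distribute = solve 4 (λ q s n e → q :* (con 1ℚ :+ s :- n :* e) := q :* (con 1ℚ :+ s) :- (q :* n) :* e) refl
      rescale : ℚ.1/ n ℚ.* (1ℚ ℚ.+ s ℚ.- n ℚ.* zeroExtend x a) ≡ μ a
      rescale = trans (distribute (ℚ.1/ n) s n (zeroExtend x a))
        (cong (λ c → ℚ.1/ n ℚ.* (1ℚ ℚ.+ s) ℚ.- c)
          (trans (cong (ℚ._* zeroExtend x a) (ℚ.*-inverseˡ n)) (ℚ.*-identityˡ (zeroExtend x a))))

    Σμ≡1 : sumℚ μ ≡ 1ℚ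
    Σμ≡1 = begin
      sumℚ μ
        ≡⟨ ℚΣ.sum-distrib-+ (λ _ → ℚ.1/ n ℚ.* (1ℚ ℚ.+ s)) (λ a → ℚ.- zeroExtend x a) ⟩
      sumℚ {suc d} (λ _ → ℚ.1/ n ℚ.* (1ℚ ℚ.+ s)) ℚ.+ sumℚ (λ a → ℚ.- zeroExtend x a)
        ≡⟨ cong₂ ℚ._+_ (sum-const {suc d} (ℚ.1/ n ℚ.* (1ℚ ℚ.+ s)))
                       (trans (ℚΣ.sum-neg (zeroExtend x)) (cong ℚ.-_ (sum-zeroExtend x))) ⟩
      n ℚ.* (ℚ.1/ n ℚ.* (1ℚ ℚ.+ s)) ℚ.- s
        ≡⟨ cong (ℚ._- s) (trans (≡.sym (ℚ.*-assoc n (ℚ.1/ n) (1ℚ ℚ.+ s)))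
                                (cong (ℚ._* (1ℚ ℚ.+ s)) (ℚ.*-inverseʳ n))) ⟩
      1ℚ ℚ.* (1ℚ ℚ.+ s) ℚ.- s
        ≡⟨ cancel s ⟩
      1ℚ ∎
      where
      open ≡-Reasoning
      cancel : ∀ s → 1ℚ ℚ.* (1ℚ ℚ.+ s) ℚ.- s ≡ 1ℚ
      cancel = solve 1 (λ s → con 1ℚ :* (con 1ℚ :+ s) :- s := con 1ℚ) refl

    preimage : Pt d
    preimage m = sumℚ (λ i → μ i ℚ.* laplacianVertex G i m)

    preimage-inLaplacianSimplex : InLaplacianSimplex G preimage
    preimage-inLaplacianSimplex = μ , μ≥0 , Σμ≡1 , (λ _ → refl)

    image-preimage : ∀ j → x j ≡ image preimage j
    image-preimage j = ≡.sym (begin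
      image preimage j
        ≡⟨ image-convex μ preimage (λ _ → refl) j ⟩
      μ (fromℕ d) ℚ.- μ (inject₁ j)
        ≡⟨ cong₂ (λ e e′ → (c ℚ.- e) ℚ.- (c ℚ.- e′)) (zeroExtend-fromℕ x) (zeroExtend-inject₁ x j) ⟩
      (c ℚ.- 0ℚ) ℚ.- (c ℚ.- x j)
        ≡⟨ cancel c (x j) ⟩
      x j ∎)
      where
      open ≡-Reasoning
      c : ℚ
      c = ℚ.1/ n ℚ.* (1ℚ ℚ.+ s)
      cancel : ∀ c e → (c ℚ.- 0ℚ) ℚ.- (c ℚ.- e) ≡ e
      cancel = solve 2 (λ c e → (c :- con 0ℚ) :- (c :- e) := e) refl

laplacianSimplex≅dual-complete : ∀ {d} (G : Graph (suc d)) → IsUnimodular (reducedLaplacian G) →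
  UnimodEquiv (InLaplacianSimplex G) (InDual (InLaplacianSimplex (complete (suc d))))
laplacianSimplex≅dual-complete G (W , LW≡I , WL≡I) =
  negate W , origin , negate-unimodular (reducedLaplacian G , WL≡I , LW≡I) ,
  (λ x x∈dual → let open Backward x x∈dual in preimage , preimage-inLaplacianSimplex , image-preimage) ,
  (λ y (λs , λs≥0 , Σλs≡1 , y≡) → Forward.image-inDual λs λs≥0 Σλs≡1 y y≡)
  where open LaplacianSimplexImage G W LW≡I

-- Rooted trees

least : ∀ {P : ℕ → Set} → Decidable P → ∀ m → P m → Σ ℕ λ k → P k × (∀ j → j < k → ¬ P j)
least P? zero p = zero , p , λ _ ()
least P? (suc m) p with P? zero
... | yes p0 = zero , p0 , λ _ ()
... | no ¬p0 with least (P? ∘ suc) m p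
...   | k , pk , below = suc k , pk , λ where
          zero _ → ¬p0
          (suc j) (s≤s j<k) → below j j<k

greatest : ∀ {P : ℕ → Set} → Decidable P → P zero →
           ∀ m → Σ ℕ λ k → k ≤ m × P k × (∀ j → k < j → j ≤ m → ¬ P j)
greatest {P} P? p0 zero = zero , z≤n , p0 , λ j k<j j≤0 → ⊥-elim (ℕ.<-irrefl refl (ℕ.<-≤-trans k<j j≤0))
greatest {P} P? p0 (suc m) with P? (suc m)
... | yes pm = suc m , ℕ.≤-refl , pm , λ j k<j j≤m → ⊥-elim (ℕ.<-irrefl refl (ℕ.<-≤-trans k<j j≤m))
... | no ¬pm with greatest P? p0 m
...   | k , k≤m , pk , above = k , ℕ.m≤n⇒m≤1+n k≤m , pk , above′
  where
  above′ : ∀ j → k < j → j ≤ suc m → ¬ P j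
  above′ j k<j j≤1+m with ℕ.m≤n⇒m<n∨m≡n j≤1+m
  ... | inj₁ j<1+m = above j k<j (ℕ.s≤s⁻¹ j<1+m)
  ... | inj₂ refl = ¬pm

∸-pred : ∀ {m n} → suc m ≤ n → n ∸ m ≡ suc (n ∸ suc m)
∸-pred {m} {suc n} (s≤s m≤n) = ℕ.+-∸-assoc 1 m≤n

∸-suc< : ∀ {m n} → suc m ≤ n → n ∸ suc m < n
∸-suc< {m} {suc n} _ = s≤s (ℕ.m∸n≤m n m)

module RootedTree {d : ℕ} (G : Graph (suc d)) (connected : Connected G) where

  root : Fin (suc d)
  root = fromℕ d

  Adj? : ∀ i k → Dec (Adj G i k)
  Adj? i k = adj G i k Bool.≟ true

  adj-sym : ∀ {i k} → Adj G i k → Adj G k i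
  adj-sym {i} {k} i~k = trans (Graph.sym G k i) i~k

  adj-irrefl : ∀ {i} → ¬ Adj G i i
  adj-irrefl {i} i~i with trans (≡.sym i~i) (irrefl G i)
  ... | ()

  Within : ℕ → Fin (suc d) → Set
  Within zero i = i ≡ root
  Within (suc m) i = Within m i ⊎ ∃ λ k → Adj G i k × Within m k

  within? : ∀ m → Decidable (Within m)
  within? zero i = i ≟ root
  within? (suc m) i = within? m i ⊎-dec any? (λ k → Adj? i k ×-dec within? m k)

  walk-within : ∀ {i} (w : Walk G i root) → Σ ℕ λ m → Within m i
  walk-within (here _) = zero , refl
  walk-within (step i~j w) with walk-within w
  ... | m , within = suc m , inj₂ (_ , i~j , within)

  private
    shortest : ∀ i → Σ ℕ λ k → Within k i × (∀ j → j < k → ¬ Within j i)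
    shortest i = let m , within = walk-within (connected i root) in least (λ k → within? k i) m within

  depth : Fin (suc d) → ℕ
  depth i = proj₁ (shortest i)

  within-depth : ∀ i → Within (depth i) i
  within-depth i = proj₁ (proj₂ (shortest i))

  depth-minimal : ∀ i {m} → Within m i → depth i ≤ m
  depth-minimal i {m} within with depth i ℕ.≤? m
  ... | yes depth≤m = depth≤m
  ... | no depth≰m = ⊥-elim (proj₂ (proj₂ (shortest i)) m (ℕ.≰⇒> depth≰m) within)

  depth-root : depth root ≡ 0
  depth-root = ℕ.n≤0⇒n≡0 (depth-minimal root refl)

  depth≡0⇒root : ∀ {i} → depth i ≡ 0 → i ≡ root
  depth≡0⇒root {i} depth≡0 = subst (λ m → Within m i) depth≡0 (within-depth i)

  depth-adj : ∀ {i k} → Adj G i k → depth i ≤ suc (depth k)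
  depth-adj {i} {k} i~k = depth-minimal i (inj₂ (k , i~k , within-depth k))

  step-to-root : ∀ i → i ≢ root → ∃ λ k → Adj G i k × suc (depth k) ≡ depth i
  step-to-root i i≢root with depth i in depth≡ | within-depth i
  ... | zero | within = ⊥-elim (i≢root within)
  ... | suc m | inj₁ within = ⊥-elim (ℕ.1+n≰n (subst (_≤ m) depth≡ (depth-minimal i within)))
  ... | suc m | inj₂ (k , i~k , within) =
    k , i~k , cong suc (ℕ.≤-antisym (depth-minimal k within) (ℕ.s≤s⁻¹ (subst (_≤ suc (depth k)) depth≡ (depth-adj i~k))))

  parent : Fin (suc d) → Fin (suc d)
  parent i with i ≟ root
  ... | yes _ = root
  ... | no i≢root = proj₁ (step-to-root i i≢root)

  parent-root : parent root ≡ root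
  parent-root with root ≟ root
  ... | yes _ = refl
  ... | no root≢root = ⊥-elim (root≢root refl)

  parent-adj : ∀ {i} → i ≢ root → Adj G i (parent i)
  parent-adj {i} i≢root with i ≟ root
  ... | yes i≡root = ⊥-elim (i≢root i≡root)
  ... | no i≢root = proj₁ (proj₂ (step-to-root i i≢root))

  depth-parent : ∀ {i} → i ≢ root → depth i ≡ suc (depth (parent i))
  depth-parent {i} i≢root with i ≟ root
  ... | yes i≡root = ⊥-elim (i≢root i≡root)
  ... | no i≢root = ≡.sym (proj₂ (proj₂ (step-to-root i i≢root)))

  depth-parent-∸ : ∀ i → depth (parent i) ≡ depth i ∸ 1
  depth-parent-∸ i with i ≟ root
  ... | yes refl = trans depth-root (cong (_∸ 1) (≡.sym depth-root))
  ... | no i≢root = cong (_∸ 1) (proj₂ (proj₂ (step-to-root i i≢root)))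

  depth≡suc⇒≢root : ∀ {i m} → depth i ≡ suc m → i ≢ root
  depth≡suc⇒≢root {i} depth≡ refl with trans (≡.sym depth≡) depth-root
  ... | ()

  ancestor : ℕ → Fin (suc d) → Fin (suc d)
  ancestor zero x = x
  ancestor (suc t) x = ancestor t (parent x)

  ancestor-suc : ∀ t w → ancestor (suc t) w ≡ parent (ancestor t w)
  ancestor-suc zero w = refl
  ancestor-suc (suc t) w = ancestor-suc t (parent w)

  depth-ancestor : ∀ t w → depth (ancestor t w) ≡ depth w ∸ t
  depth-ancestor zero w = refl
  depth-ancestor (suc t) w = begin
    depth (ancestor t (parent w)) ≡⟨ depth-ancestor t (parent w) ⟩
    depth (parent w) ∸ t          ≡⟨ cong (_∸ t) (depth-parent-∸ w) ⟩
    depth w ∸ 1 ∸ t               ≡⟨ ℕ.∸-+-assoc (depth w) 1 t ⟩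
    depth w ∸ suc t               ∎
    where open ≡-Reasoning

  ancestor-depth : ∀ w → ancestor (depth w) w ≡ root
  ancestor-depth w = depth≡0⇒root (trans (depth-ancestor (depth w) w) (ℕ.n∸n≡0 (depth w)))

  ancestor-root : ∀ t → ancestor t root ≡ root
  ancestor-root zero = refl
  ancestor-root (suc t) = trans (cong (ancestor t) parent-root) (ancestor-root t)

  ancestorAt : Fin (suc d) → ℕ → Fin (suc d)
  ancestorAt w ℓ = ancestor (depth w ∸ ℓ) w

  infix 4 _≼_ _≼?_

  _≼_ : Fin (suc d) → Fin (suc d) → Set
  v ≼ x = ancestorAt x (depth v) ≡ v

  _≼?_ : ∀ v x → Dec (v ≼ x)
  v ≼? x = ancestorAt x (depth v) ≟ v

  ≼-refl : ∀ x → x ≼ x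
  ≼-refl x = cong (λ t → ancestor t x) (ℕ.n∸n≡0 (depth x))

  ≼⇒depth≤ : ∀ {v x} → v ≼ x → depth v ≤ depth x
  ≼⇒depth≤ {v} {x} v≼x with depth v ℕ.≤? depth x
  ... | yes depth≤ = depth≤
  ... | no depth≰ = ⊥-elim (ℕ.<-irrefl (cong depth x≡v) (ℕ.≰⇒> depth≰))
    where
    x≡v : x ≡ v
    x≡v = trans (cong (λ t → ancestor t x) (≡.sym (ℕ.m≤n⇒m∸n≡0 (ℕ.<⇒≤ (ℕ.≰⇒> depth≰))))) v≼x

  ≼-unique : ∀ {v v′ x} → v ≼ x → v′ ≼ x → depth v ≡ depth v′ → v ≡ v′
  ≼-unique {x = x} v≼x v′≼x depth≡ = trans (≡.sym v≼x) (trans (cong (ancestorAt x) depth≡) v′≼x)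

  root≼ : ∀ x → root ≼ x
  root≼ x = trans (cong (ancestorAt x) depth-root) (ancestor-depth x)

  ≼root⇒≡root : ∀ {v} → v ≼ root → v ≡ root
  ≼root⇒≡root {v} v≼root = trans (≡.sym v≼root) (ancestor-root (depth root ∸ depth v))

  module _ {x : Fin (suc d)} (x≢root : x ≢ root) where

    private
      depth∸ : ∀ {v} → depth v ≤ depth (parent x) → depth x ∸ depth v ≡ suc (depth (parent x) ∸ depth v)
      depth∸ {v} le = trans (cong (_∸ depth v) (depth-parent x≢root)) (ℕ.+-∸-assoc 1 le)

    ≼-parent : ∀ {v} → v ≼ parent x → v ≼ x
    ≼-parent {v} v≼px = trans (cong (λ t → ancestor t x) (depth∸ (≼⇒depth≤ v≼px))) v≼px

    ≼-parent⇒≢ : ∀ {v} → v ≼ parent x → v ≢ x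
    ≼-parent⇒≢ {v} v≼px refl = ℕ.1+n≰n (subst (_≤ depth (parent x)) (depth-parent x≢root) (≼⇒depth≤ v≼px))

    ≼-step : ∀ {v} → v ≼ x → v ≼ parent x ⊎ v ≡ x
    ≼-step {v} v≼x with depth v ℕ.≤? depth (parent x)
    ... | yes le = inj₁ (trans (cong (λ t → ancestor t x) (≡.sym (depth∸ le))) v≼x)
    ... | no nle = inj₂ (≡.sym (trans (cong (λ t → ancestor t x) (≡.sym x∸v≡0)) v≼x))
      where
      x∸v≡0 : depth x ∸ depth v ≡ 0
      x∸v≡0 = ℕ.m≤n⇒m∸n≡0 (subst (_≤ depth v) (≡.sym (depth-parent x≢root)) (ℕ.≰⇒> nle))

  parent-≼ : ∀ {v b} → v ≢ root → v ≼ b → parent v ≼ b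
  parent-≼ {v} {b} v≢root v≼b = begin
    ancestor (depth b ∸ depth (parent v)) b ≡⟨ cong (λ t → ancestor t b) b∸pv ⟩
    ancestor (suc (depth b ∸ depth v)) b    ≡⟨ ancestor-suc (depth b ∸ depth v) b ⟩
    parent (ancestor (depth b ∸ depth v) b) ≡⟨ cong parent v≼b ⟩
    parent v                                ∎
    where
    open ≡-Reasoning
    v≤b : suc (depth (parent v)) ≤ depth b
    v≤b = subst (_≤ depth b) (depth-parent v≢root) (≼⇒depth≤ v≼b)
    b∸pv : depth b ∸ depth (parent v) ≡ suc (depth b ∸ depth v)
    b∸pv = trans (∸-pred v≤b) (cong (λ h → suc (depth b ∸ h)) (≡.sym (depth-parent v≢root)))

  child-toward : ∀ {i b} → i ≼ b → i ≢ b → Σ (Fin (suc d)) λ k → (k ≢ root × parent k ≡ i) × k ≼ b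
  child-toward {i} {b} i≼b i≢b = k , (depth≡suc⇒≢root depth-k , parent-k) , cong (ancestorAt b) depth-k
    where
    i<b : suc (depth i) ≤ depth b
    i<b = ℕ.≤∧≢⇒< (≼⇒depth≤ i≼b) (λ depth≡ → i≢b (≼-unique i≼b (≼-refl b) depth≡))
    t : ℕ
    t = depth b ∸ suc (depth i)
    k : Fin (suc d)
    k = ancestor t b
    depth-k : depth k ≡ suc (depth i)
    depth-k = trans (depth-ancestor t b) (ℕ.m∸[m∸n]≡n i<b)
    parent-k : parent k ≡ i
    parent-k = trans (≡.sym (ancestor-suc t b)) (trans (cong (λ t → ancestor t b) (≡.sym (∸-pred i<b))) i≼b)

  private
    descend : ∀ {k w} → suc k ≤ depth w → w ≢ root × k ≤ depth (parent w)
    descend {k} {w} k<w = w≢root , subst (k ≤_) (≡.sym (depth-parent-∸ w)) (ℕ.∸-monoˡ-≤ 1 k<w)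
      where
      w≢root : w ≢ root
      w≢root w≡root with subst (suc k ≤_) (trans (cong depth w≡root) depth-root) k<w
      ... | ()

    depth-parent-∸-suc : ∀ k w → depth (parent w) ∸ k ≡ depth w ∸ suc k
    depth-parent-∸-suc k w = trans (cong (_∸ k) (depth-parent-∸ w)) (ℕ.∸-+-assoc (depth w) 1 k)

  pathUp : ℕ → Fin (suc d) → List (Fin (suc d))
  pathUp zero x = []
  pathUp (suc k) x = x ∷ pathUp k (parent x)

  pathDown : ℕ → Fin (suc d) → List (Fin (suc d))
  pathDown zero x = []
  pathDown (suc k) x = pathDown k (parent x) ∷ʳ x

  ∈-pathUp : ∀ k w {u} → u ∈ pathUp k w → k ≤ depth w → u ≼ w × depth w ∸ k < depth u
  ∈-pathUp (suc k) w (here refl) k<w = ≼-refl w , ∸-suc< k<w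
  ∈-pathUp (suc k) w {u} (there u∈) k<w with descend k<w
  ... | w≢root , k≤pw with ∈-pathUp k (parent w) u∈ k≤pw
  ...   | u≼pw , below = ≼-parent w≢root u≼pw , subst (_< depth u) (depth-parent-∸-suc k w) below

  ∈-pathDown : ∀ k w {u} → u ∈ pathDown k w → k ≤ depth w → u ≼ w × depth w ∸ k < depth u
  ∈-pathDown (suc k) w {u} u∈ k<w with descend k<w | ∈-++⁻ (pathDown k (parent w)) u∈
  ... | w≢root , k≤pw | inj₁ u∈′ with ∈-pathDown k (parent w) u∈′ k≤pw
  ...   | u≼pw , below = ≼-parent w≢root u≼pw , subst (_< depth u) (depth-parent-∸-suc k w) below
  ∈-pathDown (suc k) w u∈ k<w | _ | inj₂ (here refl) = ≼-refl w , ∸-suc< k<w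

  pathUp-unique : ∀ k w → k ≤ depth w → Unique (pathUp k w)
  pathUp-unique zero w _ = []
  pathUp-unique (suc k) w k<w with descend k<w
  ... | w≢root , k≤pw =
    All.tabulate (λ u∈ w≡u → ≼-parent⇒≢ w≢root (proj₁ (∈-pathUp k (parent w) u∈ k≤pw)) (≡.sym w≡u))
    ∷ pathUp-unique k (parent w) k≤pw

  pathDown-unique : ∀ k w → k ≤ depth w → Unique (pathDown k w)
  pathDown-unique zero w _ = []
  pathDown-unique (suc k) w k<w with descend k<w
  ... | w≢root , k≤pw = AllPairs.++⁺ (pathDown-unique k (parent w) k≤pw) ([] ∷ [])
    (All.tabulate (λ u∈ → ≼-parent⇒≢ w≢root (proj₁ (∈-pathDown k (parent w) u∈ k≤pw)) ∷ []))

  pathUp-linked : ∀ k w ys → k ≤ depth w → Linked (Adj G) (ancestor k w ∷ ys) →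
                  Linked (Adj G) (pathUp k w ++ ancestor k w ∷ ys)
  pathUp-linked zero w ys _ linked = linked
  pathUp-linked (suc zero) w ys k<w linked = parent-adj (proj₁ (descend k<w)) ∷ linked
  pathUp-linked (suc (suc k)) w ys k<w linked =
    parent-adj (proj₁ (descend k<w)) ∷ pathUp-linked (suc k) (parent w) ys (proj₂ (descend k<w)) linked

  pathDown-linked : ∀ k w ys → k ≤ depth w → Linked (Adj G) (w ∷ ys) →
                    Linked (Adj G) (ancestor k w ∷ pathDown k w ++ ys)
  pathDown-linked zero w ys _ linked = linked
  pathDown-linked (suc k) w ys k<w linked =
    subst (λ zs → Linked (Adj G) (ancestor k (parent w) ∷ zs)) (≡.sym (List.++-assoc (pathDown k (parent w)) (w ∷ []) ys))
      (pathDown-linked k (parent w) (w ∷ ys) (proj₂ (descend k<w)) (adj-sym (parent-adj (proj₁ (descend k<w))) ∷ linked))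

  closed-walk⇒cycle : ∀ {x y} a k₁ k₂ → 0 < k₁ → 0 < k₂ → Adj G y x →
    Unique (pathUp k₁ x ++ a ∷ pathDown k₂ y) → Linked (Adj G) (pathUp k₁ x ++ a ∷ pathDown k₂ y) →
    HasCycle G
  closed-walk⇒cycle {x} {y} a (suc k₁) (suc k₂) _ _ y~x unique linked =
    x , middle , y , length-middle (pathUp k₁ (parent x)) ,
    subst Unique as-cycle unique , subst (Linked (Adj G)) as-cycle linked , y~x
    where
    middle : List (Fin (suc d))
    middle = pathUp k₁ (parent x) ++ a ∷ pathDown k₂ (parent y)
    as-cycle : pathUp (suc k₁) x ++ a ∷ pathDown (suc k₂) y ≡ x ∷ (middle ∷ʳ y)
    as-cycle = cong (x ∷_) (≡.sym (List.++-assoc (pathUp k₁ (parent x)) (a ∷ pathDown k₂ (parent y)) (y ∷ [])))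
    length-middle : ∀ us → 1 ≤ length (us ++ a ∷ pathDown k₂ (parent y))
    length-middle [] = s≤s z≤n
    length-middle (_ ∷ _) = s≤s z≤n

  ≼-adj⇒parent : ∀ {x y} → x ≼ y → Adj G y x → parent y ≡ x
  ≼-adj⇒parent {x} {y} x≼y y~x with depth y ℕ.≤? depth x
  ... | yes y≤x = ⊥-elim (adj-irrefl (subst (Adj G y) (≡.sym y≡x) y~x))
    where
    y≡x : y ≡ x
    y≡x = trans (cong (λ t → ancestor t y) (≡.sym (ℕ.m≤n⇒m∸n≡0 y≤x))) x≼y
  ... | no y≰x = trans (cong (λ t → ancestor t y) (≡.sym y∸x≡1)) x≼y
    where
    y∸x≡1 : depth y ∸ depth x ≡ 1
    y∸x≡1 = trans (cong (_∸ depth x) (ℕ.≤-antisym (depth-adj y~x) (ℕ.≰⇒> y≰x))) (ℕ.m+n∸n≡m 1 (depth x))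

  -- a is the lowest common ancestor of x and y, at depth s; the two tree paths
  -- from x and y up to a, closed by the edge y ~ x, form a cycle.
  module CycleThroughAncestor {x y : Fin (suc d)} (y~x : Adj G y x) (s : ℕ)
    (s<x : s < depth x) (s<y : s < depth y) (agree : ancestorAt x s ≡ ancestorAt y s)
    (disagree-above : ∀ ℓ → s < ℓ → ℓ ≤ depth x → ancestorAt x ℓ ≢ ancestorAt y ℓ) where

    k₁ k₂ : ℕ
    k₁ = depth x ∸ s
    k₂ = depth y ∸ s

    a : Fin (suc d)
    a = ancestorAt x s

    k₁≤x : k₁ ≤ depth x
    k₁≤x = ℕ.m∸n≤m (depth x) s

    k₂≤y : k₂ ≤ depth y
    k₂≤y = ℕ.m∸n≤m (depth y) s

    depth-a : depth a ≡ s
    depth-a = trans (depth-ancestor k₁ x) (ℕ.m∸[m∸n]≡n (ℕ.<⇒≤ s<x))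

    ∈-up : ∀ {u} → u ∈ pathUp k₁ x → u ≼ x × s < depth u
    ∈-up u∈ with ∈-pathUp k₁ x u∈ k₁≤x
    ... | u≼x , below = u≼x , subst (_< _) (ℕ.m∸[m∸n]≡n (ℕ.<⇒≤ s<x)) below

    ∈-down : ∀ {u} → u ∈ pathDown k₂ y → u ≼ y × s < depth u
    ∈-down u∈ with ∈-pathDown k₂ y u∈ k₂≤y
    ... | u≼y , below = u≼y , subst (_< _) (ℕ.m∸[m∸n]≡n (ℕ.<⇒≤ s<y)) below

    a∉down : ∀ {u} → u ∈ pathDown k₂ y → a ≢ u
    a∉down u∈ a≡u = ℕ.<-irrefl (trans (≡.sym depth-a) (cong depth a≡u)) (proj₂ (∈-down u∈))

    disjoint : ∀ {u u′} → u ∈ pathUp k₁ x → u′ ∈ a ∷ pathDown k₂ y → u ≢ u′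
    disjoint u∈ (here refl) u≡a = ℕ.<-irrefl (trans (≡.sym depth-a) (≡.sym (cong depth u≡a))) (proj₂ (∈-up u∈))
    disjoint {u} u∈ (there u′∈) refl with ∈-up u∈ | ∈-down u′∈
    ... | u≼x , s<u | u≼y , _ = disagree-above (depth u) s<u (≼⇒depth≤ u≼x) (trans u≼x (≡.sym u≼y))

    unique : Unique (pathUp k₁ x ++ a ∷ pathDown k₂ y)
    unique = AllPairs.++⁺ (pathUp-unique k₁ x k₁≤x) (All.tabulate a∉down ∷ pathDown-unique k₂ y k₂≤y)
      (All.tabulate (λ u∈ → All.tabulate (disjoint u∈)))

    linked : Linked (Adj G) (pathUp k₁ x ++ a ∷ pathDown k₂ y)
    linked = pathUp-linked k₁ x (pathDown k₂ y) k₁≤x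
      (subst (λ zs → Linked (Adj G) (a ∷ zs)) (List.++-identityʳ (pathDown k₂ y))
        (subst (λ z → Linked (Adj G) (z ∷ pathDown k₂ y ++ [])) (≡.sym agree) (pathDown-linked k₂ y [] k₂≤y [-])))

    cycle : HasCycle G
    cycle = closed-walk⇒cycle a k₁ k₂ (ℕ.m<n⇒0<n∸m s<x) (ℕ.m<n⇒0<n∸m s<y) y~x unique linked

  non-tree-edge⇒cycle : ∀ {x y} → Adj G x y → parent x ≢ y → parent y ≢ x → HasCycle G
  non-tree-edge⇒cycle {x} {y} x~y px≢y py≢x
    with greatest (λ ℓ → ancestorAt x ℓ ≟ ancestorAt y ℓ)
                  (trans (ancestor-depth x) (≡.sym (ancestor-depth y))) (depth x)
  ... | s , s≤x , agree , disagree-above with s ℕ.≟ depth x | s ℕ.≟ depth y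
  ...   | yes refl | _ = ⊥-elim (py≢x (≼-adj⇒parent (trans (≡.sym agree) (≼-refl x)) (adj-sym x~y)))
  ...   | no _ | yes refl = ⊥-elim (px≢y (≼-adj⇒parent (trans agree (≼-refl y)) x~y))
  ...   | no s≢x | no s≢y = CycleThroughAncestor.cycle (adj-sym x~y) s s<x s<y agree disagree-above
    where
    s<x : s < depth x
    s<x = ℕ.≤∧≢⇒< s≤x s≢x
    s<y : s < depth y
    s<y = ℕ.≤∧≢⇒< (ℕ.s≤s⁻¹ (ℕ.≤-trans s<x (depth-adj x~y))) s≢y

  IsParentOf : Fin (suc d) → Fin (suc d) → Set
  IsParentOf k i = i ≢ root × parent i ≡ k

  isParentOf? : ∀ k i → Dec (IsParentOf k i)
  isParentOf? k i = ¬? (i ≟ root) ×-dec parent i ≟ k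

  𝟙[_≼_] : Fin (suc d) → Fin (suc d) → ℤ
  𝟙[ v ≼ x ] = indicator (v ≼? x)

  𝟙≼-step : ∀ {x} v → x ≢ root → 𝟙[ v ≼ x ] ≡ 𝟙[ v ≼ parent x ] ℤ.+ indicator (v ≟ x)
  𝟙≼-step {x} v x≢root with v ≼? x | v ≼? parent x | v ≟ x
  ... | yes _ | yes v≼px | yes v≡x = ⊥-elim (≼-parent⇒≢ x≢root v≼px v≡x)
  ... | yes _ | yes _ | no _ = refl
  ... | yes _ | no _ | yes _ = refl
  ... | yes v≼x | no v⋠px | no v≢x with ≼-step x≢root v≼x
  ...   | inj₁ v≼px = ⊥-elim (v⋠px v≼px)
  ...   | inj₂ v≡x = ⊥-elim (v≢x v≡x)
  𝟙≼-step v x≢root | no v⋠x | yes v≼px | _ = ⊥-elim (v⋠x (≼-parent x≢root v≼px))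
  𝟙≼-step v x≢root | no v⋠x | no _ | yes refl = ⊥-elim (v⋠x (≼-refl v))
  𝟙≼-step v x≢root | no _ | no _ | no _ = refl

  commonAncestors : Fin (suc d) → Fin (suc d) → ℤ
  commonAncestors a b = sumℤ (λ v → 𝟙[ inject₁ v ≼ a ] ℤ.* 𝟙[ inject₁ v ≼ b ])

  commonAncestors-sym : ∀ a b → commonAncestors a b ≡ commonAncestors b a
  commonAncestors-sym a b = ℤΣ.sum-cong (λ v → ℤ.*-comm 𝟙[ inject₁ v ≼ a ] 𝟙[ inject₁ v ≼ b ])

  commonAncestors-root : ∀ b → commonAncestors root b ≡ + 0
  commonAncestors-root b = ℤΣ.sum-zero (λ v →
    cong (ℤ._* 𝟙[ inject₁ v ≼ b ]) (indicator-no (inject₁ v ≼? root) (fromℕ≢inject₁ ∘ ≡.sym ∘ ≼root⇒≡root)))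

  commonAncestors-parent : ∀ {a} b → a ≢ root → commonAncestors a b ≡ commonAncestors (parent a) b ℤ.+ 𝟙[ a ≼ b ]
  commonAncestors-parent {a} b a≢root with view a
  ... | ‵fromℕ = ⊥-elim (a≢root refl)
  ... | ‵inject₁ a′ = begin
    sumℤ (λ v → 𝟙[ inject₁ v ≼ a ] ℤ.* B v)
      ≡⟨ ℤΣ.sum-cong (λ v → trans (cong (ℤ._* B v) (𝟙≼-step (inject₁ v) a≢root))
                                  (ℤ.*-distribʳ-+ (B v) 𝟙[ inject₁ v ≼ parent a ] (E v))) ⟩
    sumℤ (λ v → 𝟙[ inject₁ v ≼ parent a ] ℤ.* B v ℤ.+ E v ℤ.* B v)
      ≡⟨ ℤΣ.sum-distrib-+ (λ v → 𝟙[ inject₁ v ≼ parent a ] ℤ.* B v) (λ v → E v ℤ.* B v) ⟩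
    commonAncestors (parent a) b ℤ.+ sumℤ (λ v → E v ℤ.* B v)
      ≡⟨ cong (ℤ._+_ (commonAncestors (parent a) b))
              (trans (ℤΣ.sum-cong (λ v → cong (ℤ._* B v) (indicator-inject₁ v a′))) (sum-indicator B a′)) ⟩
    commonAncestors (parent a) b ℤ.+ 𝟙[ a ≼ b ] ∎
    where
    open ≡-Reasoning
    B E : Fin d → ℤ
    B v = 𝟙[ inject₁ v ≼ b ]
    E v = indicator (inject₁ v ≟ a)

  commonAncestors-child : ∀ {p c} b → IsParentOf p c → commonAncestors c b ≡ commonAncestors p b ℤ.+ 𝟙[ c ≼ b ]
  commonAncestors-child {c = c} b (c≢root , pc≡p) =
    trans (commonAncestors-parent b c≢root) (cong (λ v → commonAncestors v b ℤ.+ 𝟙[ c ≼ b ]) pc≡p)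

  parent-asym : ∀ {i k} → IsParentOf k i → ¬ IsParentOf i k
  parent-asym {i} {k} (i≢root , pi≡k) (k≢root , pk≡i) = ℕ.1+n≰n (ℕ.≤-trans (ℕ.n≤1+n (suc (depth i))) (ℕ.≤-reflexive i≡2+i))
    where
    i≡2+i : suc (suc (depth i)) ≡ depth i
    i≡2+i = begin
      suc (suc (depth i))            ≡⟨ cong (λ v → suc (suc (depth v))) pk≡i ⟨
      suc (suc (depth (parent k)))   ≡⟨ cong suc (depth-parent k≢root) ⟨
      suc (depth k)                  ≡⟨ cong (λ v → suc (depth v)) pi≡k ⟨
      suc (depth (parent i))         ≡⟨ depth-parent i≢root ⟨
      depth i                        ∎
      where open ≡-Reasoning

  parent-count : ∀ i → sumℤ (λ k → indicator (isParentOf? k i)) ≡ indicator (¬? (i ≟ root))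
  parent-count i = count (i ≟ root)
    where
    count : (D : Dec (i ≡ root)) → sumℤ (λ k → indicator (isParentOf? k i)) ≡ indicator (¬? D)
    count (yes i≡root) = count-none (λ k → isParentOf? k i) (λ k (i≢root , _) → i≢root i≡root)
    count (no i≢root) = count-unique (λ k → isParentOf? k i) (parent i) (i≢root , refl) (λ k (_ , pi≡k) → ≡.sym pi≡k)

  children-on-path-count : ∀ i b →
    sumℤ (λ k → indicator (isParentOf? i k) ℤ.* 𝟙[ k ≼ b ]) ≡ 𝟙[ i ≼ b ] ℤ.- indicator (i ≟ b)
  children-on-path-count i b = trans (ℤΣ.sum-cong (λ k → indicator-× (isParentOf? i k) (k ≼? b))) (count (i ≼? b) (i ≟ b))
    where
    P? : ∀ k → Dec (IsParentOf i k × k ≼ b)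
    P? k = isParentOf? i k ×-dec k ≼? b
    count : (D : Dec (i ≼ b)) (E : Dec (i ≡ b)) → sumℤ (λ k → indicator (P? k)) ≡ indicator D ℤ.- indicator E
    count (yes i≼b) (no i≢b) with child-toward i≼b i≢b
    ... | k₀ , parent-k₀ , k₀≼b = count-unique P? k₀ (parent-k₀ , k₀≼b)
            (λ k ((k≢root , pk≡i) , k≼b) → ≼-unique k≼b k₀≼b
              (trans (depth-parent k≢root) (trans (cong (λ v → suc (depth v)) (trans pk≡i (≡.sym (proj₂ parent-k₀))))
                (≡.sym (depth-parent (proj₁ parent-k₀))))))
    count (yes _) (yes refl) = count-none P? (λ k ((k≢root , pk≡i) , k≼i) →
      ℕ.1+n≰n (subst (_≤ depth (parent k)) (depth-parent k≢root)
                (subst (λ v → depth k ≤ depth v) (≡.sym pk≡i) (≼⇒depth≤ k≼i))))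
    count (no i⋠b) (yes i≡b) = ⊥-elim (i⋠b (subst (i ≼_) i≡b (≼-refl i)))
    count (no i⋠b) (no _) =
      count-none P? (λ k ((k≢root , pk≡i) , k≼b) → i⋠b (subst (_≼ b) pk≡i (parent-≼ k≢root k≼b)))

  module _ (acyclic : ¬ HasCycle G) where

    adj⇒parent : ∀ {x y} → Adj G x y → parent x ≡ y ⊎ parent y ≡ x
    adj⇒parent {x} {y} x~y with parent x ≟ y | parent y ≟ x
    ... | yes px≡y | _ = inj₁ px≡y
    ... | no _ | yes py≡x = inj₂ py≡x
    ... | no px≢y | no py≢x = ⊥-elim (acyclic (non-tree-edge⇒cycle x~y px≢y py≢x))

    adjacency≡parent+child : ∀ i k → adjacency G i k ≡ indicator (isParentOf? k i) ℤ.+ indicator (isParentOf? i k)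
    adjacency≡parent+child i k = trans (adjacency≡indicator G i k) (edge (Adj? i k) (isParentOf? k i) (isParentOf? i k))
      where
      parent-edge : ∀ {i k} → IsParentOf k i → Adj G i k
      parent-edge (i≢root , refl) = parent-adj i≢root
      ≢root : ∀ {i k} → Adj G i k → parent i ≡ k → i ≢ root
      ≢root {i} i~k pi≡k refl = adj-irrefl (subst (Adj G root) (trans (≡.sym pi≡k) parent-root) i~k)
      edge : (A : Dec (Adj G i k)) (P : Dec (IsParentOf k i)) (C : Dec (IsParentOf i k)) →
             indicator A ≡ indicator P ℤ.+ indicator C
      edge (yes _) (yes p) (yes c) = ⊥-elim (parent-asym p c)
      edge (yes _) (yes _) (no _) = refl
      edge (yes _) (no _) (yes _) = refl
      edge (yes i~k) (no ¬p) (no ¬c) with adj⇒parent i~k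
      ... | inj₁ pi≡k = ⊥-elim (¬p (≢root i~k pi≡k , pi≡k))
      ... | inj₂ pk≡i = ⊥-elim (¬c (≢root (adj-sym i~k) pk≡i , pk≡i))
      edge (no ¬i~k) (yes p) _ = ⊥-elim (¬i~k (parent-edge p))
      edge (no ¬i~k) (no _) (yes c) = ⊥-elim (¬i~k (adj-sym (parent-edge c)))
      edge (no _) (no _) (no _) = refl

    edges-commonAncestors : ∀ i b →
      sumℤ (λ k → adjacency G i k ℤ.* (commonAncestors i b ℤ.- commonAncestors k b))
      ≡ indicator (¬? (i ≟ root)) ℤ.* 𝟙[ i ≼ b ] ℤ.- (𝟙[ i ≼ b ] ℤ.- indicator (i ≟ b))
    edges-commonAncestors i b = begin
      sumℤ (λ k → adjacency G i k ℤ.* (W i ℤ.- W k))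
        ≡⟨ ℤΣ.sum-cong (λ k → trans (cong (ℤ._* (W i ℤ.- W k)) (adjacency≡parent+child i k))
                                    (ℤ.*-distribʳ-+ (W i ℤ.- W k) (P k) (C k))) ⟩
      sumℤ (λ k → P k ℤ.* (W i ℤ.- W k) ℤ.+ C k ℤ.* (W i ℤ.- W k))
        ≡⟨ ℤΣ.sum-distrib-+ (λ k → P k ℤ.* (W i ℤ.- W k)) (λ k → C k ℤ.* (W i ℤ.- W k)) ⟩
      sumℤ (λ k → P k ℤ.* (W i ℤ.- W k)) ℤ.+ sumℤ (λ k → C k ℤ.* (W i ℤ.- W k))
        ≡⟨ cong₂ ℤ._+_ (ℤΣ.sum-cong up-edge) (ℤΣ.sum-cong down-edge) ⟩
      sumℤ (λ k → P k ℤ.* 𝟙[ i ≼ b ]) ℤ.+ sumℤ (λ k → ℤ.- (C k ℤ.* 𝟙[ k ≼ b ]))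
        ≡⟨ cong₂ ℤ._+_ (trans (ℤΣ.sum-*ʳ 𝟙[ i ≼ b ] P) (cong (ℤ._* 𝟙[ i ≼ b ]) (parent-count i)))
                       (trans (ℤΣ.sum-neg (λ k → C k ℤ.* 𝟙[ k ≼ b ])) (cong ℤ.-_ (children-on-path-count i b))) ⟩
      indicator (¬? (i ≟ root)) ℤ.* 𝟙[ i ≼ b ] ℤ.- (𝟙[ i ≼ b ] ℤ.- indicator (i ≟ b)) ∎
      where
      open ≡-Reasoning
      W P C : Fin (suc d) → ℤ
      W k = commonAncestors k b
      P k = indicator (isParentOf? k i)
      C k = indicator (isParentOf? i k)
      [x+y]-x≡y : ∀ x y → (x ℤ.+ y) ℤ.- x ≡ y
      [x+y]-x≡y = solve-∀
      x-[x+y]≡-y : ∀ x y → x ℤ.- (x ℤ.+ y) ≡ ℤ.- y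
      x-[x+y]≡-y = solve-∀
      up-edge : ∀ k → P k ℤ.* (W i ℤ.- W k) ≡ P k ℤ.* 𝟙[ i ≼ b ]
      up-edge k = indicator-*-cong (isParentOf? k i) λ k-parent →
        trans (cong (ℤ._- W k) (commonAncestors-child b k-parent)) ([x+y]-x≡y (W k) 𝟙[ i ≼ b ])
      down-edge : ∀ k → C k ℤ.* (W i ℤ.- W k) ≡ ℤ.- (C k ℤ.* 𝟙[ k ≼ b ])
      down-edge k = trans
        (indicator-*-cong (isParentOf? i k) λ i-parent →
          trans (cong (ℤ._-_ (W i)) (commonAncestors-child b i-parent)) (x-[x+y]≡-y (W i) 𝟙[ k ≼ b ]))
        (≡.sym (ℤ.neg-distribʳ-* (C k) 𝟙[ k ≼ b ]))

    laplacian-commonAncestors : ∀ i b →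
      sumℤ (λ k → laplacian G i k ℤ.* commonAncestors k b) ≡ indicator (i ≟ b) ℤ.- indicator (i ≟ root)
    laplacian-commonAncestors i b =
      trans (laplacian-apply G (λ k → commonAncestors k b) i) (trans (edges-commonAncestors i b) (combine (i ≟ root)))
      where
      combine : (D : Dec (i ≡ root)) → indicator (¬? D) ℤ.* 𝟙[ i ≼ b ] ℤ.- (𝟙[ i ≼ b ] ℤ.- indicator (i ≟ b))
                                       ≡ indicator (i ≟ b) ℤ.- indicator D
      combine (yes i≡root) = trans (cong (λ x → + 0 ℤ.* x ℤ.- (x ℤ.- indicator (i ≟ b))) i≼b≡1)
                                   (root-row (indicator (i ≟ b)))
        where
        i≼b≡1 : 𝟙[ i ≼ b ] ≡ + 1
        i≼b≡1 = indicator-yes (i ≼? b) (subst (_≼ b) (≡.sym i≡root) (root≼ b))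
        root-row : ∀ e → + 0 ℤ.* + 1 ℤ.- (+ 1 ℤ.- e) ≡ e ℤ.- + 1
        root-row = solve-∀
      combine (no _) = other-row 𝟙[ i ≼ b ] (indicator (i ≟ b))
        where
        other-row : ∀ x e → + 1 ℤ.* x ℤ.- (x ℤ.- e) ≡ e ℤ.- + 0
        other-row = solve-∀

    reducedLaplacian-unimodular : IsUnimodular (reducedLaplacian G)
    reducedLaplacian-unimodular = W̃ , L̃W̃≡I , W̃L̃≡I
      where
      L̃ W̃ : Mat d
      L̃ = reducedLaplacian G
      W̃ m j = commonAncestors (inject₁ m) (inject₁ j)
      L̃W̃≡I : ∀ m j → (L̃ ⊗ W̃) m j ≡ idMat m j
      L̃W̃≡I m j = begin
        (L̃ ⊗ W̃) m j
          ≡⟨ ℤ.+-identityʳ _ ⟨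
        (L̃ ⊗ W̃) m j ℤ.+ + 0
          ≡⟨ cong (ℤ._+_ ((L̃ ⊗ W̃) m j)) (trans (≡.sym (ℤ.*-zeroʳ (laplacian G (inject₁ m) root)))
                (cong (laplacian G (inject₁ m) root ℤ.*_) (≡.sym (commonAncestors-root (inject₁ j))))) ⟩
        (L̃ ⊗ W̃) m j ℤ.+ laplacian G (inject₁ m) root ℤ.* commonAncestors root (inject₁ j)
          ≡⟨ ℤΣ.sum-init-last (λ k → laplacian G (inject₁ m) k ℤ.* commonAncestors k (inject₁ j)) ⟨
        sumℤ (λ k → laplacian G (inject₁ m) k ℤ.* commonAncestors k (inject₁ j))
          ≡⟨ laplacian-commonAncestors (inject₁ m) (inject₁ j) ⟩
        indicator (inject₁ m ≟ inject₁ j) ℤ.- indicator (inject₁ m ≟ root)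
          ≡⟨ cong₂ ℤ._-_ (indicator-inject₁ m j) (indicator-no (inject₁ m ≟ root) (fromℕ≢inject₁ ∘ ≡.sym)) ⟩
        idMat m j ℤ.- + 0
          ≡⟨ ℤ.+-identityʳ (idMat m j) ⟩
        idMat m j ∎
        where open ≡-Reasoning
      W̃L̃≡I : ∀ m j → (W̃ ⊗ L̃) m j ≡ idMat m j
      W̃L̃≡I m j = begin
        (W̃ ⊗ L̃) m j
          ≡⟨ ℤΣ.sum-cong (λ k → trans (ℤ.*-comm (W̃ m k) (L̃ k j))
               (cong₂ ℤ._*_ (laplacian-sym G (inject₁ k) (inject₁ j)) (commonAncestors-sym (inject₁ m) (inject₁ k)))) ⟩
        (L̃ ⊗ W̃) j m
          ≡⟨ L̃W̃≡I j m ⟩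
        idMat j m
          ≡⟨ indicator-sym j m ⟩
        idMat m j ∎
        where open ≡-Reasoning

theorem4p8 : (d : ℕ) → 2 ≤ d → (T : Graph (suc d)) → IsTree T →
    UnimodEquiv (InLaplacianSimplex T) (InDual (InLaplacianSimplex (complete (suc d))))
theorem4p8 d _ T (connected , acyclic) =
  laplacianSimplex≅dual-complete T (RootedTree.reducedLaplacian-unimodular T connected acyclic)
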